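{- Let $P(x)=x^{2}+p_{1}x+p_{0}\in\mathbb{Z}[x]$ with $|p_{0}|\geq 2$, let $\varepsilon\in[0,1)$, and let $k=\lfloor \varepsilon|p_{0}|\rfloor$ (so that $\mathcal{N}_{\varepsilon}=\{ -k,\dots,|p_{0}|-1-k\}$). (i) Suppose $\varepsilon\in[0,\tfrac12)$, or $\varepsilon=\tfrac12$ and $|p_0|$ is odd. Then $P$ is an $\varepsilon$-CNS polynomial if and only if either $-k-1\leq p_{1}\leq |p_{0}|-k$ and $p_{0}\geq 2$, or $k+2-|p_{0}|\leq p_{1}\leq k-1$, $p_{0}\leq -3$, and $\varepsilon\in[\tfrac{1}{|p_{0}|},\tfrac12]$. (ii) Suppose $\varepsilon\in(\tfrac12,1)$, or $\varepsilon=\tfrac12$ and $|p_0|$ is even. Then $P$ is an $\varepsilon$-CNS polynomial if and only if either $-|p_{0}|+k\leq p_{1}\leq k+1$ and $p_{0}\geq 2$, or $-k+1\leq p_{1}\leq -k-2+|p_{0}|$, $p_{0}\leq -3$, and $\varepsilon\in[\tfrac12,\tfrac{|p_{0}|-1}{|p_{0}|})$.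
   Context: Let $P(x)=x^{d}+p_{d-1}x^{d-1}+\dots+p_1x+p_0\in\mathbb{Z}[x]$ be monic with $|p_0|\ge 2$, and $\varepsilon\in[0,1)$. Put $\mathcal{N}_{\varepsilon}=[-\varepsilon|p_0|,(1-\varepsilon)|p_0|)\cap\mathbb{Z}$. The pair $(P,\mathcal{N}_\varepsilon)$ is an $\varepsilon$-canonical number system, and $P$ is called an $\varepsilon$-CNS polynomial, if for every $a\in\mathbb{Z}[x]$ there exist an integer $l>0$ and digits $d_0,\dots,d_{l-1}\in\mathcal{N}_\varepsilon$ with $a\equiv\sum_{j=0}^{l-1}d_jx^j \pmod{P}$.
   Formalization: The parameter ε ranges over the rationals in $[0,1)$. -}

module Defs where

open import Data.Nat using (ℕ; suc)
open import Data.Integer using (ℤ; +_; -_; _+_; _*_; ∣_∣) renaming (_≤_ to _≤ℤ_)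
open import Data.Rational using (ℚ; _/_; floor; 0ℚ; 1ℚ) renaming (_*_ to _*ℚ_; _-_ to _-ℚ_; _≤_ to _≤ℚ_; _<_ to _<ℚ_; -_ to -ℚ_)
open import Data.List using (List; []; _∷_; map; length)
open import Data.List.Relation.Unary.All using (All)
open import Data.Product using (Σ; _×_)
open import Relation.Binary.PropositionalEquality using (_≡_)

-- Polynomials in ℤ[x] as coefficient lists, lowest degree first.
Poly : Set
Poly = List ℤ

addP : Poly → Poly → Poly
addP [] ys = ys
addP (x ∷ xs) [] = x ∷ xs
addP (x ∷ xs) (y ∷ ys) = (x + y) ∷ addP xs ys

negP : Poly → Poly
negP = map -_

mulP : Poly → Poly → Poly
mulP [] ys = []
mulP (x ∷ xs) ys = addP (map (x *_) ys) (+ 0 ∷ mulP xs ys)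

_≈P_ : Poly → Poly → Set
a ≈P b = All (_≡ + 0) (addP a (negP b))

_≡_[modP_] : Poly → Poly → Poly → Set
a ≡ b [modP m ] = Σ Poly (λ q → addP a (negP b) ≈P mulP q m)

absQ : ℤ → ℚ
absQ p0 = (+ ∣ p0 ∣) / 1

fromℤ : ℤ → ℚ
fromℤ z = z / 1

InDigits : ℚ → ℤ → ℤ → Set
InDigits ε p0 d = (-ℚ (ε *ℚ absQ p0) ≤ℚ fromℤ d) × (fromℤ d <ℚ ((1ℚ -ℚ ε) *ℚ absQ p0))

IsεCNS : ℚ → ℤ → Poly → Set
IsεCNS ε p0 P = (a : Poly) → Σ Poly (λ ds →
  (1 Data.Nat.≤ length ds) × All (InDigits ε p0) ds × (a ≡ ds [modP P ]))

quadP : ℤ → ℤ → Poly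
quadP p1 p0 = p0 ∷ p1 ∷ + 1 ∷ []

kOf : ℚ → ℤ → ℤ
kOf ε p0 = floor (ε *ℚ absQ p0)

-- Write a − Σ dᵢ xⁱ = q · (x² + p1 x + p0). Comparing coefficients, the quotient coefficient qᵢ is the
-- unique w with q_{i−2} + p1 q_{i−1} + p0 w − aᵢ ∈ −N_ε, and the digit dᵢ is then determined. Hence P is
-- an ε-CNS polynomial iff every orbit of τ (u , v) = (v , w), u + p1 v + p0 w ∈ −N_ε, reaches the origin
-- of ℤ²; ε only enters through k = ⌊ε|p0|⌋, as −N_ε = [k + 1 − |p0|, k].
-- Inside the stated ranges we use Brunotte's criterion: τ (x + y) = τ x + (y₂ , δ) with (y₂ , δ) a
-- successor of y, so a set containing ±e₁, ±e₂ and closed under successors (the box {−1, 0, 1}², or a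
-- twelve-point set when p1 = p0 and k = 0) whose points reach the origin forces all orbits to do so.
-- Outside the ranges τ has a fixed point, a 2-cycle or an invariant cone avoiding the origin.
-- Negation conjugates the systems for k and |p0| − 1 − k, so case (ii), where |p0| ≤ 2k + 1, reduces to
-- case (i), where 2k + 1 ≤ |p0|.
module Submission where

open import Defs
open import Data.Nat using (ℕ; _%_)
open import Data.Integer using (ℤ; +_; -_; _+_; _-_; ∣_∣; _≤_)
open import Data.Rational using (ℚ; 0ℚ; 1ℚ; ½) renaming (_*_ to _*ℚ_; _-_ to _-ℚ_; _≤_ to _≤ℚ_; _<_ to _<ℚ_)
open import Data.Product using (_×_)
open import Data.Sum using (_⊎_)
open import Function.Bundles using (_⇔_)
open import Relation.Binary.PropositionalEquality using (_≡_)

open import Data.Nat as ℕ using (zero; suc; z≤n; s≤s)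
import Data.Nat.Properties as ℕ
open import Data.Nat.DivMod using (m*n%n≡0)
open import Data.Nat.Coprimality as Coprimality using ()
open import Data.Integer hiding (suc; pred; _/_; _%_)
import Data.Integer as ℤ using (_/_; _%_)
open import Data.Integer.Properties
open import Data.Integer.DivMod using (a≡a%n+[a/n]*n; n%d<d; [n/d]*d≤n)
open import Data.Integer.Tactic.RingSolver using (solve)
open import Data.Rational as ℚ using (mkℚ; floor; *≤*; *<*)
import Data.Rational.Properties as ℚ
open import Data.Rational.Solver using (module +-*-Solver)
open import Algebra.Properties.Group ℚ.+-0-group using () renaming (⁻¹-involutive to ℚ-neg-involutive)
open import Data.List using ([]; _∷_; map; length)
open import Data.List.Relation.Unary.All as All using (All)
open import Data.Product using (Σ; ∃-syntax; _,_; proj₁; proj₂; map₂)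
open import Data.Sum using (inj₁; inj₂; [_,_]′) renaming (map₂ to ⊎-map₂)
open import Data.Empty using (⊥; ⊥-elim)
open import Function.Base using (_∘_; id)
open import Function.Bundles using (mk⇔; Equivalence)
open import Function.Construct.Composition using (_⇔-∘_)
open import Relation.Binary.PropositionalEquality
open import Relation.Nullary using (¬_; yes; no)

infixl 6 _⊕_
infixr 7 _⊛_

≤-by : ∀ {a b e} → + 0 ≤ e → b ≡ a + e → a ≤ b
≤-by {a} 0≤e refl = ≤-trans (≤-reflexive (sym (+-identityʳ a))) (+-monoʳ-≤ a 0≤e)

<-by : ∀ {a b e} → + 0 ≤ e → b ≡ + 1 + a + e → a < b
<-by 0≤e eq = suc[i]≤j⇒i<j (≤-by 0≤e eq)

infeasible : ∀ {e} → + 0 ≤ e → + 0 ≡ + 1 + e → ⊥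
infeasible 0≤e eq with ≤-by {a = + 1} 0≤e eq
... | +≤+ ()

slack : ∀ {a b} → a ≤ b → + 0 ≤ b - a
slack = i≤j⇒0≤j-i

_⊕_ : ∀ {a b} → + 0 ≤ a → + 0 ≤ b → + 0 ≤ a + b
_⊕_ = +-mono-≤

_⊛_ : ∀ {a} (n : ℕ) → + 0 ≤ a → + 0 ≤ + n * a
_⊛_ {a} n 0≤a = subst (_≤ + n * a) (*-zeroʳ (+ n)) (*-monoˡ-≤-nonNeg (+ n) 0≤a)

0≤+_ : ∀ n → + 0 ≤ + n
0≤+ n = +≤+ z≤n

0≤* : ∀ {a b} → + 0 ≤ a → + 0 ≤ b → + 0 ≤ a * b
0≤* (+≤+ {n = n} _) 0≤b = n ⊛ 0≤b

<⇒+1≤ : ∀ {a b} → a < b → a + + 1 ≤ b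
<⇒+1≤ {a} a<b = subst (_≤ _) (+-comm (+ 1) a) (i<j⇒suc[i]≤j a<b)

≤⊎> : ∀ a b → a ≤ b ⊎ b + + 1 ≤ a
≤⊎> a b with a ≤? b
... | yes a≤b = inj₁ a≤b
... | no a≰b = inj₂ (<⇒+1≤ (≰⇒> a≰b))

≤-by-contradiction : ∀ {a b} → (b + + 1 ≤ a → ⊥) → a ≤ b
≤-by-contradiction {a} {b} b<a⇒⊥ = [ id , ⊥-elim ∘ b<a⇒⊥ ]′ (≤⊎> a b)

module _ (P : ℤ) {{_ : Positive P}} where
  private instance
    P≥0 : NonNegative P
    P≥0 = nonNegative (<⇒≤ (positive⁻¹ P))

  *-monoˡ-≤-positive : ∀ {a b} → a ≤ b → P * a ≤ P * b
  *-monoˡ-≤-positive = *-monoˡ-≤-nonNeg P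

  *-cancelˡ-<-positive : ∀ {a b} → P * a < P * b → a < b
  *-cancelˡ-<-positive = *-cancelˡ-<-nonNeg P

ℤ-induction : (Q : ℤ → Set) → Q (+ 0) → (∀ {a} → Q a → Q (1ℤ + a)) → (∀ {a} → Q a → Q (-1ℤ + a)) → ∀ a → Q a
ℤ-induction Q q₀ up down (+ zero) = q₀
ℤ-induction Q q₀ up down +[1+ n ] = up (ℤ-induction Q q₀ up down (+ n))
ℤ-induction Q q₀ up down -[1+ zero ] = down q₀
ℤ-induction Q q₀ up down -[1+ suc n ] = down (ℤ-induction Q q₀ up down -[1+ n ])

Point : Set
Point = ℤ × ℤ

origin : Point
origin = + 0 , + 0

infixl 6 _⊞_
_⊞_ : Point → Point → Point
(a , b) ⊞ (c , d) = a + c , b + d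

negate : Point → Point
negate (a , b) = - a , - b

±P-multiple-bounded : ∀ {P p0 n t} {{_ : Positive P}} → p0 ≡ P ⊎ p0 ≡ - P →
                      P * - + n < p0 * t → p0 * t < P * + n → (- + n < t) × (t < + n)
±P-multiple-bounded {P} {p0} {n} {t} p0≡±P lo hi with p0≡±P
... | inj₁ refl = *-cancelˡ-<-positive P lo , *-cancelˡ-<-positive P hi
... | inj₂ refl = flip (*-cancelˡ-<-positive P (subst (_< _) -P*t≡P*-t hi))
                , neg-cancel-< (*-cancelˡ-<-positive P (subst (_ <_) -P*t≡P*-t lo))
  where
  -P*t≡P*-t : - P * t ≡ P * - t
  -P*t≡P*-t = trans (sym (neg-distribˡ-* P t)) (neg-distribʳ-* P t)
  flip : ∀ {a b} → - a < b → - b < a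
  flip {a} -a<b = subst (_ <_) (neg-involutive a) (neg-mono-< -a<b)

±P-multiple : ∀ {P p0} → p0 ≡ P ⊎ p0 ≡ - P → ∀ q → ∃[ w ] p0 * w ≡ P * q
±P-multiple (inj₁ refl) q = q , refl
±P-multiple {P} (inj₂ refl) q = - q , solve (P ∷ q ∷ [])

-1<t<1⇒t≡0 : ∀ {t} → - + 1 < t → t < + 1 → t ≡ + 0
-1<t<1⇒t≡0 lo hi = ≤-antisym (i<j⇒i≤pred[j] hi) (i<j⇒suc[i]≤j lo)

module Dynamics (P p0 p1 k : ℤ) {{_ : Positive P}} (p0≡±P : p0 ≡ P ⊎ p0 ≡ - P) where

  private instance
    P≢0 : NonZero P
    P≢0 = >-nonZero (positive⁻¹ P)

  -- InWindow x says that -x is a digit: for k = ⌊ε|p0|⌋ the window is -N_ε.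
  InWindow : ℤ → Set
  InWindow x = (k + + 1 - P ≤ x) × (x ≤ k)

  AbsBelowP : ℤ → Set
  AbsBelowP x = (+ 1 - P ≤ x) × (x ≤ P - + 1)

  0∈window : + 0 ≤ k → k + + 1 ≤ P → InWindow (+ 0)
  0∈window 0≤k k<P = ≤-by (slack k<P) (solve (k ∷ P ∷ [])) , 0≤k

  window-of-remainder : ∀ {r} → + 0 ≤ r → + 1 + r ≤ P → InWindow (k - r)
  window-of-remainder {r} 0≤r r<P = ≤-by (slack r<P) (solve (k ∷ r ∷ P ∷ [])) , ≤-by 0≤r (solve (k ∷ r ∷ []))

  window-multiple : ∀ s → ∃[ q ] InWindow (s + P * q)
  window-multiple s = (k - s) ℤ./ P , subst InWindow (sym (shift (a≡a%n+[a/n]*n (k - s) P))) (window-of-remainder (0≤+ _) r<P)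
    where
    r<P : + 1 + + ((k - s) ℤ.% P) ≤ P
    r<P = subst (+ 1 + + ((k - s) ℤ.% P) ≤_) (0≤i⇒+∣i∣≡i (<⇒≤ (positive⁻¹ P))) (+≤+ (n%d<d (k - s) P))
    shift : ∀ {r q} → k - s ≡ r + q * P → s + P * q ≡ k - r
    shift {r} {q} eq = begin
      s + P * q               ≡⟨ solve (s ∷ P ∷ q ∷ k ∷ []) ⟩
      k - (k - s - q * P)     ≡⟨ cong (λ x → k - (x - q * P)) eq ⟩
      k - (r + q * P - q * P) ≡⟨ solve (k ∷ r ∷ q ∷ P ∷ []) ⟩
      k - r                   ∎
      where open ≡-Reasoning

  next-quotient : ∀ s → ∃[ w ] InWindow (s + p0 * w)
  next-quotient s with window-multiple s
  ... | q , win with ±P-multiple p0≡±P q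
  ...   | w , p0w≡Pq = w , subst InWindow (cong (λ t → s + t) (sym p0w≡Pq)) win

  window-difference : ∀ {a b} → InWindow a → InWindow b → AbsBelowP (b - a)
  window-difference {a} {b} (a-lo , a-hi) (b-lo , b-hi) =
    ≤-by (slack a-hi ⊕ slack b-lo) (solve (a ∷ b ∷ k ∷ P ∷ [])) ,
    ≤-by (slack b-hi ⊕ slack a-lo) (solve (a ∷ b ∷ k ∷ P ∷ []))

  strictly-within-P : ∀ {x} → AbsBelowP x → (P * - + 1 < x) × (x < P * + 1)
  strictly-within-P {x} (lo , hi) = <-by (slack lo) (solve (x ∷ P ∷ [])) , <-by (slack hi) (solve (x ∷ P ∷ []))

  window-unique : ∀ s w w′ → InWindow (s + p0 * w) → InWindow (s + p0 * w′) → w ≡ w′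
  window-unique s w w′ win win′ = i-j≡0⇒i≡j w w′ (-1<t<1⇒t≡0 (proj₁ bounded) (proj₂ bounded))
    where
    difference : s + p0 * w - (s + p0 * w′) ≡ p0 * (w - w′)
    difference = solve (s ∷ p0 ∷ w ∷ w′ ∷ [])
    within : (P * - + 1 < p0 * (w - w′)) × (p0 * (w - w′) < P * + 1)
    within = strictly-within-P (subst AbsBelowP difference (window-difference win′ win))
    bounded : (- + 1 < w - w′) × (w - w′ < + 1)
    bounded = ±P-multiple-bounded {n = 1} {t = w - w′} p0≡±P (proj₁ within) (proj₂ within)

  τ : Point → Point
  τ (u , v) = v , proj₁ (next-quotient (u + p1 * v))

  τ-window : ∀ u v → InWindow (u + p1 * v + p0 * proj₂ (τ (u , v)))
  τ-window u v = proj₂ (next-quotient (u + p1 * v))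

  τ-unique : ∀ u v w → InWindow (u + p1 * v + p0 * w) → τ (u , v) ≡ (v , w)
  τ-unique u v w win = cong (v ,_) (window-unique (u + p1 * v) _ w (τ-window u v) win)

  data ReachesOrigin : Point → Set where
    done : ReachesOrigin origin
    step : ∀ {z} → ReachesOrigin (τ z) → ReachesOrigin z

  reaches-via : ∀ {u v} w → InWindow (u + p1 * v + p0 * w) → ReachesOrigin (v , w) → ReachesOrigin (u , v)
  reaches-via {u} {v} w win r = step (subst ReachesOrigin (sym (τ-unique u v w win)) r)

  invariant-avoids-origin : (I : Point → Set) → (∀ {z} → I z → I (τ z)) → ¬ I origin →
                            ∀ {z} → I z → ¬ ReachesOrigin z
  invariant-avoids-origin I closed ∉I z∈I done = ∉I z∈I
  invariant-avoids-origin I closed ∉I z∈I (step r) = invariant-avoids-origin I closed ∉I (closed z∈I) r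

  fixed-point-unreachable : ∀ {z} → τ z ≡ z → z ≢ origin → ¬ ReachesOrigin z
  fixed-point-unreachable {z} τz≡z z≢0 =
    invariant-avoids-origin (_≡ z) (λ { refl → τz≡z }) (λ 0≡z → z≢0 (sym 0≡z)) refl

  two-cycle-unreachable : ∀ {a b} → τ a ≡ b → τ b ≡ a → a ≢ origin → b ≢ origin → ¬ ReachesOrigin a
  two-cycle-unreachable {a} {b} τa≡b τb≡a a≢0 b≢0 = invariant-avoids-origin Cycle τ-closed ∉Cycle (inj₁ refl)
    where
    Cycle : Point → Set
    Cycle z = z ≡ a ⊎ z ≡ b
    τ-closed : ∀ {z} → Cycle z → Cycle (τ z)
    τ-closed (inj₁ refl) = inj₂ τa≡b
    τ-closed (inj₂ refl) = inj₁ τb≡a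
    ∉Cycle : ¬ Cycle origin
    ∉Cycle (inj₁ 0≡a) = a≢0 (sym 0≡a)
    ∉Cycle (inj₂ 0≡b) = b≢0 (sym 0≡b)

  Successor : Point → ℤ → Set
  Successor (y₁ , y₂) δ = AbsBelowP (y₁ + p1 * y₂ + p0 * δ)

  successor-of-windows : ∀ x₁ x₂ y₁ y₂ w w′ → InWindow (x₁ + p1 * x₂ + p0 * w) →
                         InWindow (x₁ + y₁ + p1 * (x₂ + y₂) + p0 * w′) → Successor (y₁ , y₂) (w′ - w)
  successor-of-windows x₁ x₂ y₁ y₂ w w′ win win′ =
    subst AbsBelowP difference (window-difference win win′)
    where
    difference : x₁ + y₁ + p1 * (x₂ + y₂) + p0 * w′ - (x₁ + p1 * x₂ + p0 * w) ≡ y₁ + p1 * y₂ + p0 * (w′ - w)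
    difference = solve (x₁ ∷ x₂ ∷ y₁ ∷ y₂ ∷ p1 ∷ p0 ∷ w ∷ w′ ∷ [])

  τ-⊞ : ∀ x y → ∃[ δ ] Successor y δ × τ (x ⊞ y) ≡ τ x ⊞ (proj₂ y , δ)
  τ-⊞ (x₁ , x₂) (y₁ , y₂) =
    w′ - w , successor-of-windows x₁ x₂ y₁ y₂ w w′ (τ-window x₁ x₂) (τ-window (x₁ + y₁) (x₂ + y₂)) ,
    cong (x₂ + y₂ ,_) (sym (+-[-]-cancel w w′))
    where
    w w′ : ℤ
    w = proj₂ (τ (x₁ , x₂))
    w′ = proj₂ (τ (x₁ + y₁ , x₂ + y₂))
    +-[-]-cancel : ∀ a b → a + (b - a) ≡ b
    +-[-]-cancel a b = solve (a ∷ b ∷ [])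

  record Witnesses (V : Point → Set) : Set where
    field
      successor-closed : ∀ {y δ} → V y → Successor y δ → V (proj₂ y , δ)
      +e₁ : V (+ 1 , + 0)
      -e₁ : V (- + 1 , + 0)
      +e₂ : V (+ 0 , + 1)
      -e₂ : V (+ 0 , - + 1)

  module _ {V : Point → Set} (witnesses : Witnesses V) (V-reaches : ∀ {y} → V y → ReachesOrigin y) where
    open Witnesses witnesses

    -- τ (x ⊞ y) differs from τ x ⊞ y′ with y′ a successor of y, so an orbit from x carries one from x ⊞ y.
    reaches-⊞ : ∀ {x y} → ReachesOrigin x → V y → ReachesOrigin (x ⊞ y)
    reaches-⊞ {y = y₁ , y₂} done y∈V = subst ReachesOrigin (sym (cong₂ _,_ (+-identityˡ y₁) (+-identityˡ y₂))) (V-reaches y∈V)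
    reaches-⊞ {x} {y} (step r) y∈V =
      let δ , succ , τ-x⊞y = τ-⊞ x y in step (subst ReachesOrigin (sym τ-x⊞y) (reaches-⊞ r (successor-closed y∈V succ)))

    brunotte : ∀ z → ReachesOrigin z
    brunotte (a , b) = ℤ-induction (λ b → ReachesOrigin (a , b)) (ℤ-induction (λ a → ReachesOrigin (a , + 0)) done
        (λ {a} r → subst ReachesOrigin (cong₂ _,_ (+-comm a (+ 1)) refl) (reaches-⊞ r +e₁))
        (λ {a} r → subst ReachesOrigin (cong₂ _,_ (+-comm a -1ℤ) refl) (reaches-⊞ r -e₁)) a)
      (λ {b} r → subst ReachesOrigin (cong₂ _,_ (+-identityʳ a) (+-comm b (+ 1))) (reaches-⊞ r +e₂))
      (λ {b} r → subst ReachesOrigin (cong₂ _,_ (+-identityʳ a) (+-comm b -1ℤ)) (reaches-⊞ r -e₂)) b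

data Trit : ℤ → Set where
  −1ᵗ : Trit -1ℤ
  0ᵗ  : Trit 0ℤ
  1ᵗ  : Trit 1ℤ

trit : ∀ {t} → - + 2 < t → t < + 2 → Trit t
trit { -[1+ 0 ]} _ _ = −1ᵗ
trit { + 0} _ _ = 0ᵗ
trit { + 1} _ _ = 1ᵗ
trit { -[1+ suc n ]} (-<- (s≤s ())) _
trit { +[1+ suc n ]} _ (+<+ (s≤s (s≤s ())))

trit-bounds : ∀ {t} → Trit t → (- + 1 ≤ t) × (t ≤ + 1)
trit-bounds −1ᵗ = ≤-refl , -≤+
trit-bounds 0ᵗ = -≤+ , +≤+ z≤n
trit-bounds 1ᵗ = -≤+ , ≤-refl

Box : Point → Set
Box (y₁ , y₂) = Trit y₁ × Trit y₂

module BoxWitnesses (P p0 p1 k : ℤ) {{_ : Positive P}} (p0≡±P : p0 ≡ P ⊎ p0 ≡ - P)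
                    (p1-lo : + 1 - P ≤ p1) (p1-hi : p1 ≤ P - + 1) where
  open Dynamics P p0 p1 k p0≡±P

  p1-times-trit : ∀ {t} → Trit t → (+ 1 - P ≤ p1 * t) × (p1 * t ≤ P - + 1)
  p1-times-trit −1ᵗ = ≤-by (slack p1-hi) (solve (p1 ∷ P ∷ [])) , ≤-by (slack p1-lo) (solve (p1 ∷ P ∷ []))
  p1-times-trit 0ᵗ = ≤-by (slack 1≤P) (solve (p1 ∷ P ∷ [])) , ≤-by (slack 1≤P) (solve (p1 ∷ P ∷ []))
    where
    1≤P : + 1 ≤ P
    1≤P = i<j⇒suc[i]≤j (positive⁻¹ P)
  p1-times-trit 1ᵗ = ≤-by (slack p1-lo) (solve (p1 ∷ P ∷ [])) , ≤-by (slack p1-hi) (solve (p1 ∷ P ∷ []))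

  box-successor : ∀ {y₁ y₂ δ} → Box (y₁ , y₂) → Successor (y₁ , y₂) δ → Trit δ
  box-successor {y₁} {y₂} {δ} (t₁ , t₂) (lo , hi) = trit (proj₁ bounded) (proj₂ bounded)
    where
    y₁-bounds : (- + 1 ≤ y₁) × (y₁ ≤ + 1)
    y₁-bounds = trit-bounds t₁
    p1y₂-bounds : (+ 1 - P ≤ p1 * y₂) × (p1 * y₂ ≤ P - + 1)
    p1y₂-bounds = p1-times-trit t₂
    bounded : (- + 2 < δ) × (δ < + 2)
    bounded = ±P-multiple-bounded {n = 2} {t = δ} p0≡±P
      (<-by (slack lo ⊕ slack (proj₂ y₁-bounds) ⊕ slack (proj₂ p1y₂-bounds))
            (solve (y₁ ∷ y₂ ∷ p1 ∷ p0 ∷ δ ∷ P ∷ [])))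
      (<-by (slack hi ⊕ slack (proj₁ y₁-bounds) ⊕ slack (proj₁ p1y₂-bounds))
            (solve (y₁ ∷ y₂ ∷ p1 ∷ p0 ∷ δ ∷ P ∷ [])))

  box-witnesses : Witnesses Box
  box-witnesses = record
    { successor-closed = λ y∈Box succ → proj₂ y∈Box , box-successor y∈Box succ
    ; +e₁ = 1ᵗ , 0ᵗ
    ; -e₁ = −1ᵗ , 0ᵗ
    ; +e₂ = 0ᵗ , 1ᵗ
    ; -e₂ = 0ᵗ , −1ᵗ
    }

  box-criterion : ReachesOrigin (- + 1 , - + 1) → ReachesOrigin (- + 1 , + 0) → ReachesOrigin (- + 1 , + 1) →
                  ReachesOrigin (+ 0 , - + 1) → ReachesOrigin (+ 0 , + 1) →
                  ReachesOrigin (+ 1 , - + 1) → ReachesOrigin (+ 1 , + 0) → ReachesOrigin (+ 1 , + 1) →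
                  ∀ z → ReachesOrigin z
  box-criterion r₁ r₂ r₃ r₄ r₆ r₇ r₈ r₉ = brunotte box-witnesses box-reaches
    where
    box-reaches : ∀ {y} → Box y → ReachesOrigin y
    box-reaches (−1ᵗ , −1ᵗ) = r₁
    box-reaches (−1ᵗ , 0ᵗ) = r₂
    box-reaches (−1ᵗ , 1ᵗ) = r₃
    box-reaches (0ᵗ , −1ᵗ) = r₄
    box-reaches (0ᵗ , 0ᵗ) = done
    box-reaches (0ᵗ , 1ᵗ) = r₆
    box-reaches (1ᵗ , −1ᵗ) = r₇
    box-reaches (1ᵗ , 0ᵗ) = r₈
    box-reaches (1ᵗ , 1ᵗ) = r₉

module Mirror (P p0 p1 k k′ : ℤ) {{_ : Positive P}} (p0≡±P : p0 ≡ P ⊎ p0 ≡ - P) (k+k′+1≡P : k + k′ + + 1 ≡ P) where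
  module D = Dynamics P p0 p1 k p0≡±P
  module D′ = Dynamics P p0 p1 k′ p0≡±P

  mirror-window : ∀ {x} → D′.InWindow x → D.InWindow (- x)
  mirror-window {x} (lo , hi) = ≤-by (slack hi) lower , ≤-by (slack lo) upper
    where
    open ≡-Reasoning
    lower : - x ≡ k + + 1 - P + (k′ - x)
    lower = begin
      - x                                     ≡⟨ solve (x ∷ k ∷ k′ ∷ []) ⟩
      k + + 1 - (k + k′ + + 1) + (k′ - x)     ≡⟨ cong (λ t → k + + 1 - t + (k′ - x)) k+k′+1≡P ⟩
      k + + 1 - P + (k′ - x)                  ∎
    upper : k ≡ - x + (x - (k′ + + 1 - P))
    upper = begin
      k                                       ≡⟨ solve (x ∷ k ∷ k′ ∷ []) ⟩
      - x + (x - (k′ + + 1 - (k + k′ + + 1))) ≡⟨ cong (λ t → - x + (x - (k′ + + 1 - t))) k+k′+1≡P ⟩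
      - x + (x - (k′ + + 1 - P))              ∎

  τ-negate : ∀ z → D.τ (negate z) ≡ negate (D′.τ z)
  τ-negate (u , v) = D.τ-unique (- u) (- v) (- w) (subst D.InWindow (negated w) (mirror-window (D′.τ-window u v)))
    where
    w : ℤ
    w = proj₂ (D′.τ (u , v))
    negated : ∀ t → - (u + p1 * v + p0 * t) ≡ - u + p1 * - v + p0 * - t
    negated t = solve (u ∷ v ∷ t ∷ p1 ∷ p0 ∷ [])

  reaches-negate : ∀ {z} → D′.ReachesOrigin z → D.ReachesOrigin (negate z)
  reaches-negate D′.done = D.done
  reaches-negate {z} (D′.step r) = D.step (subst D.ReachesOrigin (sym (τ-negate z)) (reaches-negate r))

  all-reach-mirror : (∀ z → D′.ReachesOrigin z) → ∀ z → D.ReachesOrigin z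
  all-reach-mirror all′ (a , b) = subst D.ReachesOrigin (cong₂ _,_ (neg-involutive a) (neg-involutive b))
    (reaches-negate (all′ (- a , - b)))

coeff : Poly → ℕ → ℤ
coeff [] i = + 0
coeff (c ∷ cs) zero = c
coeff (c ∷ cs) (suc i) = coeff cs i

coeff-addP : ∀ a b i → coeff (addP a b) i ≡ coeff a i + coeff b i
coeff-addP [] b i = sym (+-identityˡ _)
coeff-addP (x ∷ a) [] i = sym (+-identityʳ _)
coeff-addP (x ∷ a) (y ∷ b) zero = refl
coeff-addP (x ∷ a) (y ∷ b) (suc i) = coeff-addP a b i

coeff-negP : ∀ a i → coeff (negP a) i ≡ - coeff a i
coeff-negP [] i = refl
coeff-negP (x ∷ a) zero = refl
coeff-negP (x ∷ a) (suc i) = coeff-negP a i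

coeff-map-* : ∀ c a i → coeff (map (c *_) a) i ≡ c * coeff a i
coeff-map-* c [] i = sym (*-zeroʳ c)
coeff-map-* c (x ∷ a) zero = refl
coeff-map-* c (x ∷ a) (suc i) = coeff-map-* c a i

All≡0⇔coeff≡0 : ∀ a → All (_≡ + 0) a ⇔ (∀ i → coeff a i ≡ + 0)
All≡0⇔coeff≡0 a = mk⇔ (to a) (from a)
  where
  to : ∀ a → All (_≡ + 0) a → ∀ i → coeff a i ≡ + 0
  to [] All.[] i = refl
  to (x ∷ a) (x≡0 All.∷ _) zero = x≡0
  to (x ∷ a) (_ All.∷ a≡0) (suc i) = to a a≡0 i
  from : ∀ a → (∀ i → coeff a i ≡ + 0) → All (_≡ + 0) a
  from [] _ = All.[]
  from (x ∷ a) a≡0 = a≡0 zero All.∷ from a (a≡0 ∘ suc)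

HasExpansions : (ℤ → Set) → Poly → Set
HasExpansions Digit m = (a : Poly) → Σ Poly (λ ds → (1 ℕ.≤ length ds) × All Digit ds × (a ≡ ds [modP m ]))

module Carry (p0 p1 : ℤ) where

  m : Poly
  m = quadP p1 p0

  -- carry u v q i is the coefficient of x^(i+2) in (u + v x + x² q) · (x² + p1 x + p0).
  carry : ℤ → ℤ → Poly → ℕ → ℤ
  carry u v q i = coeff (u ∷ v ∷ q) i + p1 * coeff (v ∷ q) i + p0 * coeff q i

  private
    zeros : + 0 + p1 * + 0 + p0 * + 0 ≡ + 0
    zeros = solve (p1 ∷ p0 ∷ [])

  carry-0-0-[] : ∀ i → carry (+ 0) (+ 0) [] i ≡ + 0
  carry-0-0-[] zero = zeros
  carry-0-0-[] (suc zero) = zeros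
  carry-0-0-[] (suc (suc i)) = zeros

  coeff-mulP : ∀ q i → coeff (mulP q m) i ≡ carry (+ 0) (+ 0) q i
  coeff-mulP [] i = sym (carry-0-0-[] i)
  coeff-mulP (c ∷ q) zero = lemma c
    where
    lemma : ∀ c → c * p0 + + 0 ≡ + 0 + p1 * + 0 + p0 * c
    lemma c = solve (c ∷ p1 ∷ p0 ∷ [])
  coeff-mulP (c ∷ q) (suc j) = begin
    coeff (addP (map (c *_) m) (+ 0 ∷ mulP q m)) (suc j) ≡⟨ coeff-addP (map (c *_) m) (+ 0 ∷ mulP q m) (suc j) ⟩
    coeff (map (c *_) m) (suc j) + coeff (mulP q m) j    ≡⟨ cong₂ _+_ (coeff-map-* c m (suc j)) (coeff-mulP q j) ⟩
    c * coeff m (suc j) + carry (+ 0) (+ 0) q j          ≡⟨ shift j ⟩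
    carry (+ 0) c q j                                    ∎
    where
    open ≡-Reasoning
    shift : ∀ j → c * coeff m (suc j) + carry (+ 0) (+ 0) q j ≡ carry (+ 0) c q j
    shift zero = lemma c (coeff q 0)
      where
      lemma : ∀ c q₀ → c * p1 + (+ 0 + p1 * + 0 + p0 * q₀) ≡ + 0 + p1 * c + p0 * q₀
      lemma c q₀ = solve (c ∷ q₀ ∷ p1 ∷ p0 ∷ [])
    shift (suc zero) = lemma c (coeff q 0) (coeff q 1)
      where
      lemma : ∀ c q₀ q₁ → c * + 1 + (+ 0 + p1 * q₀ + p0 * q₁) ≡ c + p1 * q₀ + p0 * q₁
      lemma c q₀ q₁ = solve (c ∷ q₀ ∷ q₁ ∷ p1 ∷ p0 ∷ [])
    shift (suc (suc l)) = trans (cong (_+ _) (*-zeroʳ c)) (+-identityˡ _)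

module Expansions (P p0 p1 k : ℤ) {{_ : Positive P}} (p0≡±P : p0 ≡ P ⊎ p0 ≡ - P)
                  (0≤k : + 0 ≤ k) (k<P : k + + 1 ≤ P)
                  (Digit : ℤ → Set) (digit⇔window : ∀ d → Digit d ⇔ Dynamics.InWindow P p0 p1 k p0≡±P (- d)) where
  open Dynamics P p0 p1 k p0≡±P
  open Carry p0 p1
  open Equivalence

  0-digit : Digit (+ 0)
  0-digit = from (digit⇔window (+ 0)) (0∈window 0≤k k<P)

  digit-of-window : ∀ {x} → InWindow x → Digit (- x)
  digit-of-window {x} win = from (digit⇔window (- x)) (subst InWindow (sym (neg-involutive x)) win)

  window-of-digits : ∀ {ds} → All Digit ds → ∀ i → InWindow (- coeff ds i)
  window-of-digits All.[] i = 0∈window 0≤k k<P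
  window-of-digits (d All.∷ _) zero = to (digit⇔window _) d
  window-of-digits (_ All.∷ ds) (suc i) = window-of-digits ds i

  Expansion : Poly → ℤ → ℤ → Poly → Poly → Set
  Expansion a u v ds q = ∀ i → coeff a i ≡ coeff ds i + carry u v q i

  Expandable : Poly → ℤ → ℤ → Set
  Expandable a u v = Σ Poly λ ds → Σ Poly λ q → (1 ℕ.≤ length ds) × All Digit ds × Expansion a u v ds q

  expansion-of-orbit : ∀ {u v} → ReachesOrigin (u , v) → Expandable [] u v
  expansion-of-orbit done = (+ 0 ∷ []) , [] , s≤s z≤n , 0-digit All.∷ All.[] , λ i → sym (cong₂ _+_ (zero-poly i) (carry-0-0-[] i))
    where
    zero-poly : ∀ i → coeff (+ 0 ∷ []) i ≡ + 0
    zero-poly zero = refl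
    zero-poly (suc i) = refl
  expansion-of-orbit {u} {v} (step r) =
    let ds , q , _ , digits , expansion = expansion-of-orbit r
        w = proj₂ (τ (u , v))
    in (- (u + p1 * v + p0 * w) ∷ ds) , (w ∷ q) , s≤s z≤n , digit-of-window (τ-window u v) All.∷ digits ,
       λ { zero → sym (+-inverseˡ (u + p1 * v + p0 * w)) ; (suc i) → expansion i }

  expansion-of-all-orbits : (∀ z → ReachesOrigin z) → ∀ a u v → Expandable a u v
  expansion-of-all-orbits reach [] u v = expansion-of-orbit (reach (u , v))
  expansion-of-all-orbits reach (c ∷ a) u v =
    let w , win = next-quotient (u + p1 * v - c)
        ds , q , _ , digits , expansion = expansion-of-all-orbits reach a v w
    in (- (u + p1 * v - c + p0 * w) ∷ ds) , (w ∷ q) , s≤s z≤n , digit-of-window win All.∷ digits ,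
       λ { zero → lemma c (u + p1 * v) (p0 * w) ; (suc i) → expansion i }
    where
    lemma : ∀ c s t → c ≡ - (s - c + t) + (s + t)
    lemma c s t = solve (c ∷ s ∷ t ∷ [])

  window-of-sum : ∀ {d x} → InWindow (- d) → + 0 ≡ d + x → InWindow x
  window-of-sum {d} {x} win eq = subst InWindow -d≡x win
    where
    open ≡-Reasoning
    cancel : ∀ d x → - d + (d + x) ≡ x
    cancel d x = solve (d ∷ x ∷ [])
    -d≡x : - d ≡ x
    -d≡x = begin
      - d           ≡⟨ sym (+-identityʳ (- d)) ⟩
      - d + + 0     ≡⟨ cong (λ t → - d + t) eq ⟩
      - d + (d + x) ≡⟨ cancel d x ⟩
      x             ∎

  orbit-of-expansion : ∀ q {u v} (e : ℕ → ℤ) → (∀ i → InWindow (- e i)) → (∀ i → + 0 ≡ e i + carry u v q i) →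
                       ReachesOrigin (u , v)
  orbit-of-expansion [] e win expansion =
    reaches-via (+ 0) (window-of-sum (win 0) (expansion 0)) (reaches-via (+ 0) (window-of-sum (win 1) (expansion 1)) done)
  orbit-of-expansion (w ∷ q) e win expansion =
    reaches-via w (window-of-sum (win 0) (expansion 0)) (orbit-of-expansion q (e ∘ suc) (win ∘ suc) (expansion ∘ suc))

  coeff-difference : ∀ a ds q i → coeff (addP (addP a (negP ds)) (negP (mulP q m))) i ≡ coeff a i - coeff ds i - carry (+ 0) (+ 0) q i
  coeff-difference a ds q i = begin
    coeff (addP (addP a (negP ds)) (negP (mulP q m))) i  ≡⟨ coeff-addP (addP a (negP ds)) (negP (mulP q m)) i ⟩
    coeff (addP a (negP ds)) i + coeff (negP (mulP q m)) i ≡⟨ cong₂ _+_ (coeff-addP a (negP ds) i) (coeff-negP (mulP q m) i) ⟩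
    coeff a i + coeff (negP ds) i - coeff (mulP q m) i   ≡⟨ cong₂ (λ s t → coeff a i + s - t) (coeff-negP ds i) (coeff-mulP q i) ⟩
    coeff a i - coeff ds i - carry (+ 0) (+ 0) q i       ∎
    where open ≡-Reasoning

  expansion⇒≡[modP] : ∀ a ds q → Expansion a (+ 0) (+ 0) ds q → a ≡ ds [modP m ]
  expansion⇒≡[modP] a ds q expansion =
    q , from (All≡0⇔coeff≡0 _) (λ i → trans (coeff-difference a ds q i)
      (trans (cong (λ t → t - coeff ds i - carry (+ 0) (+ 0) q i) (expansion i)) (cancel (coeff ds i) (carry (+ 0) (+ 0) q i))))
    where
    cancel : ∀ s t → s + t - s - t ≡ + 0
    cancel s t = solve (s ∷ t ∷ [])

  has-expansions⇔all-reach : HasExpansions Digit m ⇔ (∀ z → ReachesOrigin z)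
  has-expansions⇔all-reach = mk⇔ all-reach expansions
    where
    expansions : (∀ z → ReachesOrigin z) → HasExpansions Digit m
    expansions reach a =
      let ds , q , nonempty , digits , expansion = expansion-of-all-orbits reach a (+ 0) (+ 0)
      in ds , nonempty , digits , expansion⇒≡[modP] a ds q expansion
    all-reach : HasExpansions Digit m → ∀ z → ReachesOrigin z
    all-reach expansions (u , v) =
      let a = - (u + p1 * v) ∷ - v ∷ []
          ds , _ , digits , q , zero-coeffs = expansions a
          difference≡0 i = trans (sym (coeff-difference a ds q i)) (to (All≡0⇔coeff≡0 _) zero-coeffs i)
      in orbit-of-expansion q (coeff ds) (window-of-digits digits) (λ i → orbit-equation ds q i (difference≡0 i))
      where
      zero-by : ∀ {x y} → x ≡ + 0 → y ≡ - x → + 0 ≡ y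
      zero-by x≡0 y≡-x = sym (trans y≡-x (cong -_ x≡0))
      orbit-equation : ∀ ds q i → coeff (- (u + p1 * v) ∷ - v ∷ []) i - coeff ds i - carry (+ 0) (+ 0) q i ≡ + 0 →
                       + 0 ≡ coeff ds i + carry u v q i
      orbit-equation ds q zero h = zero-by h (lemma (coeff ds 0) (coeff q 0))
        where
        lemma : ∀ d q₀ → d + (u + p1 * v + p0 * q₀) ≡ - (- (u + p1 * v) - d - (+ 0 + p1 * + 0 + p0 * q₀))
        lemma d q₀ = solve (u ∷ v ∷ d ∷ q₀ ∷ p1 ∷ p0 ∷ [])
      orbit-equation ds q (suc zero) h = zero-by h (lemma (coeff ds 1) (coeff q 0) (coeff q 1))
        where
        lemma : ∀ d q₀ q₁ → d + (v + p1 * q₀ + p0 * q₁) ≡ - (- v - d - (+ 0 + p1 * q₀ + p0 * q₁))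
        lemma d q₀ q₁ = solve (v ∷ d ∷ q₀ ∷ q₁ ∷ p1 ∷ p0 ∷ [])
      orbit-equation ds q (suc (suc i)) h = zero-by h (lemma (coeff ds (2 ℕ.+ i)) (carry (+ 0) (+ 0) q (2 ℕ.+ i)))
        where
        lemma : ∀ d c → d + c ≡ - (+ 0 - d - c)
        lemma d c = solve (d ∷ c ∷ [])

module PositiveBox (P p1 k : ℤ) {{_ : Positive P}} (0≤k : + 0 ≤ k) (2k+1≤P : k + k + + 1 ≤ P) (2≤P : + 2 ≤ P)
                   (p1-lo : - k - + 1 ≤ p1) (p1-hi : p1 ≤ P - k) (p1<P : p1 ≤ P - + 1) where
  open Dynamics P P p1 k (inj₁ refl)

  k+1≤P : k + + 1 ≤ P
  k+1≤P = ≤-by (slack 2k+1≤P ⊕ slack 0≤k) (solve (P ∷ k ∷ []))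

  k+2≤P : k + + 2 ≤ P
  k+2≤P with ≤⊎> k (+ 0)
  ... | inj₁ k≤0 = ≤-by (slack k≤0 ⊕ slack 2≤P) (solve (P ∷ k ∷ []))
  ... | inj₂ 1≤k = ≤-by (slack 1≤k ⊕ slack 2k+1≤P) (solve (P ∷ k ∷ []))

  1-P≤p1 : + 1 - P ≤ p1
  1-P≤p1 = ≤-by (slack p1-lo ⊕ slack k+2≤P) (solve (P ∷ k ∷ p1 ∷ []))

  reaches[-1,0] : ReachesOrigin (- + 1 , + 0)
  reaches[-1,0] = reaches-via (+ 0)
    (≤-by (slack k+2≤P) (solve (P ∷ k ∷ p1 ∷ [])) ,
     ≤-by (slack 0≤k ⊕ 0≤+ 1) (solve (P ∷ k ∷ p1 ∷ [])))
    done

  module PositiveP1 (1≤p1 : + 1 ≤ p1) where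
    reaches[1,-1] : ReachesOrigin (+ 1 , - + 1)
    reaches[1,-1] = reaches-via (+ 0)
      (≤-by (slack p1-hi) (solve (P ∷ k ∷ p1 ∷ [])) ,
       ≤-by (slack 1≤p1 ⊕ slack 0≤k) (solve (P ∷ k ∷ p1 ∷ [])))
      reaches[-1,0]

    reaches[1,0] : ReachesOrigin (+ 1 , + 0)
    reaches[1,0] with ≤⊎> k (+ 0)
    ... | inj₁ k≤0 = reaches-via (- + 1)
        (≤-by (slack k≤0) (solve (P ∷ k ∷ p1 ∷ [])) ,
         ≤-by (slack 2≤P ⊕ slack 0≤k ⊕ 0≤+ 1) (solve (P ∷ k ∷ p1 ∷ [])))
        (reaches-via (+ 0)
          (≤-by (slack p1<P ⊕ slack k≤0) (solve (P ∷ k ∷ p1 ∷ [])) ,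
           ≤-by (slack 1≤p1 ⊕ slack 0≤k ⊕ 0≤+ 1) (solve (P ∷ k ∷ p1 ∷ [])))
          reaches[-1,0])
    ... | inj₂ 1≤k = reaches-via (+ 0)
        (≤-by (slack k+1≤P ⊕ 0≤+ 1) (solve (P ∷ k ∷ p1 ∷ [])) ,
         ≤-by (slack 1≤k) (solve (P ∷ k ∷ p1 ∷ [])))
        done

    reaches[-1,1] : ReachesOrigin (- + 1 , + 1)
    reaches[-1,1] with ≤⊎> p1 (k + + 1)
    ... | inj₁ p1≤k+1 = reaches-via (+ 0)
        (≤-by (slack 1≤p1 ⊕ slack k+2≤P ⊕ 0≤+ 1) (solve (P ∷ k ∷ p1 ∷ [])) ,
         ≤-by (slack p1≤k+1) (solve (P ∷ k ∷ p1 ∷ [])))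
        reaches[1,0]
    ... | inj₂ p1>k+1 = reaches-via (- + 1)
        (≤-by (slack p1>k+1) (solve (P ∷ k ∷ p1 ∷ [])) ,
         ≤-by (slack p1<P ⊕ slack 0≤k ⊕ 0≤+ 2) (solve (P ∷ k ∷ p1 ∷ [])))
        reaches[1,-1]

    reaches[0,-1] : ReachesOrigin (+ 0 , - + 1)
    reaches[0,-1] with ≤⊎> p1 (P - k - + 1)
    ... | inj₁ p1≤P-k-1 = reaches-via (+ 0)
        (≤-by (slack p1≤P-k-1) (solve (P ∷ k ∷ p1 ∷ [])) ,
         ≤-by (slack 1≤p1 ⊕ slack 0≤k ⊕ 0≤+ 1) (solve (P ∷ k ∷ p1 ∷ [])))
        reaches[-1,0]
    ... | inj₂ p1>P-k-1 = reaches-via (+ 1)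
        (≤-by (slack p1<P ⊕ slack k+1≤P ⊕ 0≤+ 1) (solve (P ∷ k ∷ p1 ∷ [])) ,
         ≤-by (slack p1>P-k-1) (solve (P ∷ k ∷ p1 ∷ [])))
        reaches[-1,1]

    reaches[-1,-1] : ReachesOrigin (- + 1 , - + 1)
    reaches[-1,-1] with ≤⊎> p1 (P - k - + 2)
    ... | inj₁ p1≤P-k-2 = reaches-via (+ 0)
        (≤-by (slack p1≤P-k-2) (solve (P ∷ k ∷ p1 ∷ [])) ,
         ≤-by (slack 1≤p1 ⊕ slack 0≤k ⊕ 0≤+ 2) (solve (P ∷ k ∷ p1 ∷ [])))
        reaches[-1,0]
    ... | inj₂ p1>P-k-2 = reaches-via (+ 1)
        (≤-by (slack p1<P ⊕ slack k+1≤P) (solve (P ∷ k ∷ p1 ∷ [])) ,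
         ≤-by (slack p1>P-k-2) (solve (P ∷ k ∷ p1 ∷ [])))
        reaches[-1,1]

    reaches[1,1] : ReachesOrigin (+ 1 , + 1)
    reaches[1,1] with ≤⊎> p1 (k - + 1)
    ... | inj₁ p1≤k-1 = reaches-via (+ 0)
        (≤-by (slack p1-lo ⊕ slack 2k+1≤P) (solve (P ∷ k ∷ p1 ∷ [])) ,
         ≤-by (slack p1≤k-1) (solve (P ∷ k ∷ p1 ∷ [])))
        reaches[1,0]
    ... | inj₂ p1>k-1 = reaches-via (- + 1)
        (≤-by (slack p1>k-1) (solve (P ∷ k ∷ p1 ∷ [])) ,
         ≤-by (slack p1<P ⊕ slack 0≤k) (solve (P ∷ k ∷ p1 ∷ [])))
        reaches[1,-1]

    reaches[0,1] : ReachesOrigin (+ 0 , + 1)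
    reaches[0,1] with ≤⊎> p1 k
    ... | inj₁ p1≤k = reaches-via (+ 0)
        (≤-by (slack 1≤p1 ⊕ slack k+1≤P ⊕ 0≤+ 1) (solve (P ∷ k ∷ p1 ∷ [])) ,
         ≤-by (slack p1≤k) (solve (P ∷ k ∷ p1 ∷ [])))
        reaches[1,0]
    ... | inj₂ p1>k = reaches-via (- + 1)
        (≤-by (slack p1>k) (solve (P ∷ k ∷ p1 ∷ [])) ,
         ≤-by (slack p1-hi ⊕ 2 ⊛ slack 0≤k) (solve (P ∷ k ∷ p1 ∷ [])))
        reaches[1,-1]

    all-reach : ∀ z → ReachesOrigin z
    all-reach = BoxWitnesses.box-criterion P P p1 k (inj₁ refl) 1-P≤p1 p1<P
      reaches[-1,-1] reaches[-1,0] reaches[-1,1] reaches[0,-1] reaches[0,1] reaches[1,-1] reaches[1,0] reaches[1,1]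

  module NonPositiveP1 (p1≤0 : p1 ≤ + 0) where
    reaches[-1,-1] : ReachesOrigin (- + 1 , - + 1)
    reaches[-1,-1] = reaches-via (+ 0)
      (≤-by (slack p1≤0 ⊕ slack k+2≤P) (solve (P ∷ k ∷ p1 ∷ [])) ,
       ≤-by (slack p1-lo) (solve (P ∷ k ∷ p1 ∷ [])))
      reaches[-1,0]

    reaches[0,-1] : ReachesOrigin (+ 0 , - + 1)
    reaches[0,-1] with ≤⊎> p1 (- k - + 1)
    ... | inj₁ p1≤-k-1 = reaches-via (- + 1)
        (≤-by (slack p1≤-k-1) (solve (P ∷ k ∷ p1 ∷ [])) ,
         ≤-by (slack p1-lo ⊕ slack 2≤P ⊕ 0≤+ 1) (solve (P ∷ k ∷ p1 ∷ [])))
        reaches[-1,-1]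
    ... | inj₂ p1>-k-1 = reaches-via (+ 0)
        (≤-by (slack p1≤0 ⊕ slack k+1≤P) (solve (P ∷ k ∷ p1 ∷ [])) ,
         ≤-by (slack p1>-k-1) (solve (P ∷ k ∷ p1 ∷ [])))
        reaches[-1,0]

    reaches[1,-1] : ReachesOrigin (+ 1 , - + 1)
    reaches[1,-1] with ≤⊎> p1 (- k)
    ... | inj₁ p1≤-k = reaches-via (- + 1)
        (≤-by (slack p1≤-k) (solve (P ∷ k ∷ p1 ∷ [])) ,
         ≤-by (slack p1-lo ⊕ slack 2≤P) (solve (P ∷ k ∷ p1 ∷ [])))
        reaches[-1,-1]
    ... | inj₂ p1>-k = reaches-via (+ 0)
        (≤-by (slack p1-hi) (solve (P ∷ k ∷ p1 ∷ [])) ,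
         ≤-by (slack p1>-k) (solve (P ∷ k ∷ p1 ∷ [])))
        reaches[-1,0]

    reaches[1,0] : ReachesOrigin (+ 1 , + 0)
    reaches[1,0] with ≤⊎> k (+ 0)
    ... | inj₁ k≤0 = reaches-via (- + 1)
        (≤-by (slack k≤0) (solve (P ∷ k ∷ p1 ∷ [])) ,
         ≤-by (slack 2≤P ⊕ slack 0≤k ⊕ 0≤+ 1) (solve (P ∷ k ∷ p1 ∷ [])))
        reaches[0,-1]
    ... | inj₂ 1≤k = reaches-via (+ 0)
        (≤-by (slack k+1≤P ⊕ 0≤+ 1) (solve (P ∷ k ∷ p1 ∷ [])) ,
         ≤-by (slack 1≤k) (solve (P ∷ k ∷ p1 ∷ [])))
        done

    reaches[1,1] : ReachesOrigin (+ 1 , + 1)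
    reaches[1,1] with ≤⊎> p1 (k - + 1)
    ... | inj₁ p1≤k-1 = reaches-via (+ 0)
        (≤-by (slack p1-lo ⊕ slack 2k+1≤P) (solve (P ∷ k ∷ p1 ∷ [])) ,
         ≤-by (slack p1≤k-1) (solve (P ∷ k ∷ p1 ∷ [])))
        reaches[1,0]
    ... | inj₂ p1>k-1 = reaches-via (- + 1)
        (≤-by (slack p1>k-1) (solve (P ∷ k ∷ p1 ∷ [])) ,
         ≤-by (slack p1≤0 ⊕ slack 2≤P ⊕ slack 0≤k ⊕ 0≤+ 1) (solve (P ∷ k ∷ p1 ∷ [])))
        reaches[1,-1]

    reaches[-1,1] : ReachesOrigin (- + 1 , + 1)
    reaches[-1,1] with ≤⊎> p1 (k + + 1 - P)
    ... | inj₁ p1≤k+1-P = reaches-via (+ 1)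
        (≤-by (slack p1-lo ⊕ slack 2k+1≤P ⊕ slack 2≤P) (solve (P ∷ k ∷ p1 ∷ [])) ,
         ≤-by (slack p1≤k+1-P) (solve (P ∷ k ∷ p1 ∷ [])))
        reaches[1,1]
    ... | inj₂ p1>k+1-P = reaches-via (+ 0)
        (≤-by (slack p1>k+1-P) (solve (P ∷ k ∷ p1 ∷ [])) ,
         ≤-by (slack p1≤0 ⊕ slack 0≤k ⊕ 0≤+ 1) (solve (P ∷ k ∷ p1 ∷ [])))
        reaches[1,0]

    reaches[0,1] : ReachesOrigin (+ 0 , + 1)
    reaches[0,1] with ≤⊎> p1 (k - P)
    ... | inj₁ p1≤k-P = reaches-via (+ 1)
        (≤-by (slack p1-lo ⊕ slack 2k+1≤P ⊕ slack 2≤P ⊕ 0≤+ 1) (solve (P ∷ k ∷ p1 ∷ [])) ,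
         ≤-by (slack p1≤k-P) (solve (P ∷ k ∷ p1 ∷ [])))
        reaches[1,1]
    ... | inj₂ p1>k-P = reaches-via (+ 0)
        (≤-by (slack p1>k-P) (solve (P ∷ k ∷ p1 ∷ [])) ,
         ≤-by (slack p1≤0 ⊕ slack 0≤k) (solve (P ∷ k ∷ p1 ∷ [])))
        reaches[1,0]

    all-reach : ∀ z → ReachesOrigin z
    all-reach = BoxWitnesses.box-criterion P P p1 k (inj₁ refl) 1-P≤p1 p1<P
      reaches[-1,-1] reaches[-1,0] reaches[-1,1] reaches[0,-1] reaches[0,1] reaches[1,-1] reaches[1,0] reaches[1,1]

  all-reach : ∀ z → ReachesOrigin z
  all-reach with ≤⊎> p1 (+ 0)
  ... | inj₁ p1≤0 = NonPositiveP1.all-reach p1≤0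
  ... | inj₂ 1≤p1 = PositiveP1.all-reach 1≤p1

-- Within (i) with p0 > 0, p1 ≥ |p0| forces k = 0 and p1 = p0; the box is then not closed under successors.
module PositiveEdge (P : ℤ) {{_ : Positive P}} (2≤P : + 2 ≤ P) where
  open Dynamics P P P (+ 0) (inj₁ refl)

  data Witness : Point → Set where
    [-2,1]  : Witness (- + 2 , + 1)
    [-2,2]  : Witness (- + 2 , + 2)
    [-1,0]  : Witness (- + 1 , + 0)
    [-1,1]  : Witness (- + 1 , + 1)
    [0,-1]  : Witness (+ 0 , - + 1)
    [0,0]   : Witness (+ 0 , + 0)
    [0,1]   : Witness (+ 0 , + 1)
    [1,-2]  : Witness (+ 1 , - + 2)
    [1,-1]  : Witness (+ 1 , - + 1)
    [1,0]   : Witness (+ 1 , + 0)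
    [2,-2]  : Witness (+ 2 , - + 2)
    [2,-1]  : Witness (+ 2 , - + 1)

  lower-bound : ∀ {c δ} → P * (c - + 1) < P * δ → c ≤ δ
  lower-bound {c} {δ} lo = ≤-by (slack (<⇒+1≤ (*-cancelˡ-<-positive P lo))) (solve (c ∷ δ ∷ []))

  upper-bound : ∀ {c δ} → P * δ < P * (c + + 1) → δ ≤ c
  upper-bound {c} {δ} hi = ≤-by (slack (<⇒+1≤ (*-cancelˡ-<-positive P hi))) (solve (c ∷ δ ∷ []))

  exactly : ∀ {b δ} c → P * (c - + 1) < P * δ → P * δ < P * (c + + 1) → Witness (b , c) → Witness (b , δ)
  exactly {b} c lo hi w = subst (λ t → Witness (b , t)) (≤-antisym (lower-bound lo) (upper-bound hi)) w

  one-of-two : ∀ {b δ} c → P * (c - + 1) < P * δ → P * δ < P * (c + + 1 + + 1) →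
               Witness (b , c) → Witness (b , c + + 1) → Witness (b , δ)
  one-of-two {b} {δ} c lo hi w₁ w₂ with ≤⊎> δ c
  ... | inj₁ δ≤c = subst (λ t → Witness (b , t)) (≤-antisym (lower-bound lo) δ≤c) w₁
  ... | inj₂ c+1≤δ = subst (λ t → Witness (b , t)) (≤-antisym c+1≤δ (upper-bound hi)) w₂

  successor-closed : ∀ {y δ} → Witness y → Successor y δ → Witness (proj₂ y , δ)
  successor-closed {δ = δ} [-2,1] (lo , hi) =
    one-of-two (- + 1) (<-by (slack lo ⊕ 0≤+ 2) (solve (P ∷ δ ∷ [])))
                       (<-by (slack hi ⊕ slack 2≤P) (solve (P ∷ δ ∷ []))) [1,-1] [1,0]
  successor-closed {δ = δ} [-2,2] (lo , hi) =
    one-of-two (- + 2) (<-by (slack lo ⊕ 0≤+ 2) (solve (P ∷ δ ∷ [])))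
                       (<-by (slack hi ⊕ slack 2≤P) (solve (P ∷ δ ∷ []))) [2,-2] [2,-1]
  successor-closed {δ = δ} [-1,0] (lo , hi) =
    one-of-two (+ 0) (<-by (slack lo ⊕ 0≤+ 1) (solve (P ∷ δ ∷ [])))
                     (<-by (slack hi ⊕ slack 2≤P ⊕ 0≤+ 1) (solve (P ∷ δ ∷ []))) [0,0] [0,1]
  successor-closed {δ = δ} [-1,1] (lo , hi) =
    one-of-two (- + 1) (<-by (slack lo ⊕ 0≤+ 1) (solve (P ∷ δ ∷ [])))
                       (<-by (slack hi ⊕ slack 2≤P ⊕ 0≤+ 1) (solve (P ∷ δ ∷ []))) [1,-1] [1,0]
  successor-closed {δ = δ} [0,-1] (lo , hi) =
    exactly (+ 1) (<-by (slack lo) (solve (P ∷ δ ∷ []))) (<-by (slack hi) (solve (P ∷ δ ∷ []))) [-1,1]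
  successor-closed {δ = δ} [0,0] (lo , hi) =
    exactly (+ 0) (<-by (slack lo) (solve (P ∷ δ ∷ []))) (<-by (slack hi) (solve (P ∷ δ ∷ []))) [0,0]
  successor-closed {δ = δ} [0,1] (lo , hi) =
    exactly (- + 1) (<-by (slack lo) (solve (P ∷ δ ∷ []))) (<-by (slack hi) (solve (P ∷ δ ∷ []))) [1,-1]
  successor-closed {δ = δ} [1,-2] (lo , hi) =
    one-of-two (+ 1) (<-by (slack lo ⊕ slack 2≤P ⊕ 0≤+ 1) (solve (P ∷ δ ∷ [])))
                     (<-by (slack hi ⊕ 0≤+ 1) (solve (P ∷ δ ∷ []))) [-2,1] [-2,2]
  successor-closed {δ = δ} [1,-1] (lo , hi) =
    one-of-two (+ 0) (<-by (slack lo ⊕ slack 2≤P ⊕ 0≤+ 1) (solve (P ∷ δ ∷ [])))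
                     (<-by (slack hi ⊕ 0≤+ 1) (solve (P ∷ δ ∷ []))) [-1,0] [-1,1]
  successor-closed {δ = δ} [1,0] (lo , hi) =
    one-of-two (- + 1) (<-by (slack lo ⊕ slack 2≤P ⊕ 0≤+ 1) (solve (P ∷ δ ∷ [])))
                       (<-by (slack hi ⊕ 0≤+ 1) (solve (P ∷ δ ∷ []))) [0,-1] [0,0]
  successor-closed {δ = δ} [2,-2] (lo , hi) =
    one-of-two (+ 1) (<-by (slack lo ⊕ slack 2≤P) (solve (P ∷ δ ∷ [])))
                     (<-by (slack hi ⊕ 0≤+ 2) (solve (P ∷ δ ∷ []))) [-2,1] [-2,2]
  successor-closed {δ = δ} [2,-1] (lo , hi) =
    one-of-two (+ 0) (<-by (slack lo ⊕ slack 2≤P) (solve (P ∷ δ ∷ [])))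
                     (<-by (slack hi ⊕ 0≤+ 2) (solve (P ∷ δ ∷ []))) [-1,0] [-1,1]

  reaches[-1,0] : ReachesOrigin (- + 1 , + 0)
  reaches[-1,0] = reaches-via (+ 0) (≤-by (slack 2≤P) (solve (P ∷ [])) , ≤-by (0≤+ 1) (solve (P ∷ []))) done

  reaches[1,-1] : ReachesOrigin (+ 1 , - + 1)
  reaches[1,-1] = reaches-via (+ 0)
    (≤-by (0≤+ 0) (solve (P ∷ [])) ,
     ≤-by (slack 2≤P ⊕ 0≤+ 1) (solve (P ∷ [])))
    reaches[-1,0]

  reaches[2,-1] : ReachesOrigin (+ 2 , - + 1)
  reaches[2,-1] = reaches-via (+ 0)
    (≤-by (0≤+ 1) (solve (P ∷ [])) ,
     ≤-by (slack 2≤P) (solve (P ∷ [])))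
    reaches[-1,0]

  reaches[-1,1] : ReachesOrigin (- + 1 , + 1)
  reaches[-1,1] = reaches-via (- + 1)
    (≤-by (slack 2≤P) (solve (P ∷ [])) ,
     ≤-by (0≤+ 1) (solve (P ∷ [])))
    reaches[1,-1]

  reaches[0,1] : ReachesOrigin (+ 0 , + 1)
  reaches[0,1] = reaches-via (- + 1)
    (≤-by (slack 2≤P ⊕ 0≤+ 1) (solve (P ∷ [])) ,
     ≤-by (0≤+ 0) (solve (P ∷ [])))
    reaches[1,-1]

  reaches[0,-1] : ReachesOrigin (+ 0 , - + 1)
  reaches[0,-1] = reaches-via (+ 1)
    (≤-by (slack 2≤P ⊕ 0≤+ 1) (solve (P ∷ [])) ,
     ≤-by (0≤+ 0) (solve (P ∷ [])))
    reaches[-1,1]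

  reaches[1,0] : ReachesOrigin (+ 1 , + 0)
  reaches[1,0] = reaches-via (- + 1)
    (≤-by (0≤+ 0) (solve (P ∷ [])) ,
     ≤-by (slack 2≤P ⊕ 0≤+ 1) (solve (P ∷ [])))
    reaches[0,-1]

  reaches[-2,1] : ReachesOrigin (- + 2 , + 1)
  reaches[-2,1] with ≤⊎> P (+ 2)
  ... | inj₁ P≤2 = reaches-via (+ 0)
      (≤-by (2 ⊛ slack 2≤P ⊕ 0≤+ 1) (solve (P ∷ [])) ,
       ≤-by (slack P≤2) (solve (P ∷ [])))
      reaches[1,0]
  ... | inj₂ 3≤P = reaches-via (- + 1)
      (≤-by (slack 3≤P) (solve (P ∷ [])) ,
       ≤-by (0≤+ 2) (solve (P ∷ [])))
      reaches[1,-1]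

  reaches[1,-2] : ReachesOrigin (+ 1 , - + 2)
  reaches[1,-2] = reaches-via (+ 1)
    (≤-by (0≤+ 0) (solve (P ∷ [])) ,
     ≤-by (slack 2≤P ⊕ 0≤+ 1) (solve (P ∷ [])))
    reaches[-2,1]

  reaches[2,-2] : ReachesOrigin (+ 2 , - + 2)
  reaches[2,-2] = reaches-via (+ 1)
    (≤-by (0≤+ 1) (solve (P ∷ [])) ,
     ≤-by (slack 2≤P) (solve (P ∷ [])))
    reaches[-2,1]

  reaches[-2,2] : ReachesOrigin (- + 2 , + 2)
  reaches[-2,2] with ≤⊎> P (+ 2)
  ... | inj₁ P≤2 = reaches-via (- + 1)
      (≤-by (2 ⊛ slack 2≤P ⊕ 0≤+ 1) (solve (P ∷ [])) ,
       ≤-by (slack P≤2) (solve (P ∷ [])))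
      reaches[2,-1]
  ... | inj₂ 3≤P = reaches-via (- + 2)
      (≤-by (slack 3≤P) (solve (P ∷ [])) ,
       ≤-by (0≤+ 2) (solve (P ∷ [])))
      reaches[2,-2]

  all-reach : ∀ z → ReachesOrigin z
  all-reach = brunotte witnesses witness-reaches
    where
    witnesses : Witnesses Witness
    witnesses = record { successor-closed = successor-closed ; +e₁ = [1,0] ; -e₁ = [-1,0] ; +e₂ = [0,1] ; -e₂ = [0,-1] }
    witness-reaches : ∀ {y} → Witness y → ReachesOrigin y
    witness-reaches [-2,1] = reaches[-2,1]
    witness-reaches [-2,2] = reaches[-2,2]
    witness-reaches [-1,0] = reaches[-1,0]
    witness-reaches [-1,1] = reaches[-1,1]
    witness-reaches [0,-1] = reaches[0,-1]
    witness-reaches [0,0] = done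
    witness-reaches [0,1] = reaches[0,1]
    witness-reaches [1,-2] = reaches[1,-2]
    witness-reaches [1,-1] = reaches[1,-1]
    witness-reaches [1,0] = reaches[1,0]
    witness-reaches [2,-2] = reaches[2,-2]
    witness-reaches [2,-1] = reaches[2,-1]

module NegativeBox (P p1 k : ℤ) {{_ : Positive P}} (1≤k : + 1 ≤ k) (2k+1≤P : k + k + + 1 ≤ P)
                   (p1-lo : k + + 2 - P ≤ p1) (p1-hi : p1 ≤ k - + 1) where
  open Dynamics P (- P) p1 k (inj₂ refl)

  1-P≤p1 : + 1 - P ≤ p1
  1-P≤p1 = ≤-by (slack p1-lo ⊕ slack 1≤k ⊕ 0≤+ 2) (solve (P ∷ k ∷ p1 ∷ []))

  p1<P : p1 ≤ P - + 1
  p1<P = ≤-by (slack p1-hi ⊕ slack 2k+1≤P ⊕ slack 1≤k ⊕ 0≤+ 2) (solve (P ∷ k ∷ p1 ∷ []))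

  reaches[-1,0] : ReachesOrigin (- + 1 , + 0)
  reaches[-1,0] = reaches-via (+ 0)
    (≤-by (slack 2k+1≤P ⊕ slack 1≤k) (solve (P ∷ k ∷ p1 ∷ [])) ,
     ≤-by (slack 1≤k ⊕ 0≤+ 2) (solve (P ∷ k ∷ p1 ∷ [])))
    done

  reaches[1,0] : ReachesOrigin (+ 1 , + 0)
  reaches[1,0] = reaches-via (+ 0)
    (≤-by (slack 2k+1≤P ⊕ slack 1≤k ⊕ 0≤+ 2) (solve (P ∷ k ∷ p1 ∷ [])) ,
     ≤-by (slack 1≤k) (solve (P ∷ k ∷ p1 ∷ [])))
    done

  reaches[0,1] : ReachesOrigin (+ 0 , + 1)
  reaches[0,1] = reaches-via (+ 0)
    (≤-by (slack p1-lo ⊕ 0≤+ 1) (solve (P ∷ k ∷ p1 ∷ [])) ,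
     ≤-by (slack p1-hi ⊕ 0≤+ 1) (solve (P ∷ k ∷ p1 ∷ [])))
    reaches[1,0]

  reaches[-1,1] : ReachesOrigin (- + 1 , + 1)
  reaches[-1,1] = reaches-via (+ 0)
    (≤-by (slack p1-lo) (solve (P ∷ k ∷ p1 ∷ [])) ,
     ≤-by (slack p1-hi ⊕ 0≤+ 2) (solve (P ∷ k ∷ p1 ∷ [])))
    reaches[1,0]

  reaches[1,1] : ReachesOrigin (+ 1 , + 1)
  reaches[1,1] = reaches-via (+ 0)
    (≤-by (slack p1-lo ⊕ 0≤+ 2) (solve (P ∷ k ∷ p1 ∷ [])) ,
     ≤-by (slack p1-hi) (solve (P ∷ k ∷ p1 ∷ [])))
    reaches[1,0]

  reaches[-1,-1] : ReachesOrigin (- + 1 , - + 1)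
  reaches[-1,-1] with ≤⊎> (- + 1 - p1) k
  ... | inj₁ -1-p1≤k = reaches-via (+ 0)
      (≤-by (slack 2k+1≤P ⊕ slack p1-hi) (solve (P ∷ k ∷ p1 ∷ [])) ,
       ≤-by (slack -1-p1≤k) (solve (P ∷ k ∷ p1 ∷ [])))
      reaches[-1,0]
  ... | inj₂ -1-p1>k = reaches-via (+ 1)
      (≤-by (slack -1-p1>k) (solve (P ∷ k ∷ p1 ∷ [])) ,
       ≤-by (2 ⊛ slack 1≤k ⊕ slack p1-lo ⊕ 0≤+ 5) (solve (P ∷ k ∷ p1 ∷ [])))
      reaches[-1,1]

  reaches[0,-1] : ReachesOrigin (+ 0 , - + 1)
  reaches[0,-1] with ≤⊎> (+ 0 - p1) k
  ... | inj₁ -p1≤k = reaches-via (+ 0)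
      (≤-by (slack 2k+1≤P ⊕ slack p1-hi ⊕ 0≤+ 1) (solve (P ∷ k ∷ p1 ∷ [])) ,
       ≤-by (slack -p1≤k) (solve (P ∷ k ∷ p1 ∷ [])))
      reaches[-1,0]
  ... | inj₂ -p1>k = reaches-via (+ 1)
      (≤-by (slack -p1>k) (solve (P ∷ k ∷ p1 ∷ [])) ,
       ≤-by (2 ⊛ slack 1≤k ⊕ slack p1-lo ⊕ 0≤+ 4) (solve (P ∷ k ∷ p1 ∷ [])))
      reaches[-1,1]

  reaches[1,-1] : ReachesOrigin (+ 1 , - + 1)
  reaches[1,-1] with ≤⊎> (+ 1 - p1) k
  ... | inj₁ 1-p1≤k = reaches-via (+ 0)
      (≤-by (slack 2k+1≤P ⊕ slack p1-hi ⊕ 0≤+ 2) (solve (P ∷ k ∷ p1 ∷ [])) ,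
       ≤-by (slack 1-p1≤k) (solve (P ∷ k ∷ p1 ∷ [])))
      reaches[-1,0]
  ... | inj₂ 1-p1>k = reaches-via (+ 1)
      (≤-by (slack 1-p1>k) (solve (P ∷ k ∷ p1 ∷ [])) ,
       ≤-by (2 ⊛ slack 1≤k ⊕ slack p1-lo ⊕ 0≤+ 3) (solve (P ∷ k ∷ p1 ∷ [])))
      reaches[-1,1]

  all-reach : ∀ z → ReachesOrigin z
  all-reach = BoxWitnesses.box-criterion P (- P) p1 k (inj₂ refl) 1-P≤p1 p1<P
    reaches[-1,-1] reaches[-1,0] reaches[-1,1] reaches[0,-1] reaches[0,1] reaches[1,-1] reaches[1,0] reaches[1,1]

module PositiveNecessity (P p1 k : ℤ) {{_ : Positive P}} (0≤k : + 0 ≤ k) (2k+1≤P : k + k + + 1 ≤ P) where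
  open Dynamics P P p1 k (inj₁ refl)

  k+1≤P : k + + 1 ≤ P
  k+1≤P = ≤-by (slack 2k+1≤P ⊕ slack 0≤k) (solve (P ∷ k ∷ []))

  fixed[-1,-1] : - P - + 1 - k ≤ p1 → p1 ≤ - k - + 2 → ¬ ReachesOrigin (- + 1 , - + 1)
  fixed[-1,-1] lo hi = fixed-point-unreachable
    (τ-unique (- + 1) (- + 1) (- + 1)
      (≤-by (slack hi) (solve (P ∷ k ∷ p1 ∷ [])) ,
       ≤-by (slack lo) (solve (P ∷ k ∷ p1 ∷ []))))
    (λ ())

  descending-cone : p1 ≤ - P - + 1 → ¬ ReachesOrigin (- + 1 , - + 1)
  descending-cone p1≤-P-1 = invariant-avoids-origin Cone τ-closed (λ { (_ , ()) }) (≤-refl , ≤-refl)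
    where
    Cone : Point → Set
    Cone (u , v) = (v ≤ u) × (u ≤ - + 1)
    w≤v : ∀ {u v w} → v ≤ u → u ≤ - + 1 → u + p1 * v + P * w ≤ k → w ≤ v
    w≤v {u} {v} {w} v≤u u≤-1 x≤k = ≤-by-contradiction λ v+1≤w →
      infeasible (slack p1≤-P-1 ⊕ slack v≤u ⊕ slack x≤k ⊕ slack (*-monoˡ-≤-positive P v+1≤w)
                  ⊕ 0≤* (slack p1≤-P-1) (slack (≤-trans v≤u u≤-1)) ⊕ slack k+1≤P)
                 (solve (P ∷ k ∷ p1 ∷ u ∷ v ∷ w ∷ []))
    τ-closed : ∀ {z} → Cone z → Cone (τ z)
    τ-closed {u , v} (v≤u , u≤-1) = w≤v v≤u u≤-1 (proj₂ (τ-window u v)) , ≤-trans v≤u u≤-1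

  cycle[1,-1] : P - k + + 1 ≤ p1 → p1 ≤ P + k + + 1 → ¬ ReachesOrigin (+ 1 , - + 1)
  cycle[1,-1] lo hi = two-cycle-unreachable
    (τ-unique (+ 1) (- + 1) (+ 1)
      (≤-by (slack hi ⊕ slack 2k+1≤P) (solve (P ∷ k ∷ p1 ∷ [])) ,
       ≤-by (slack lo) (solve (P ∷ k ∷ p1 ∷ []))))
    (τ-unique (- + 1) (+ 1) (- + 1)
      (≤-by (slack lo ⊕ slack 2k+1≤P) (solve (P ∷ k ∷ p1 ∷ [])) ,
       ≤-by (slack hi) (solve (P ∷ k ∷ p1 ∷ []))))
    (λ ()) (λ ())

  alternating-cone : P + + 1 ≤ p1 → ¬ ReachesOrigin (+ 1 , - + 1)
  alternating-cone P+1≤p1 = invariant-avoids-origin Cone τ-closed ∉Cone (inj₁ (≤-refl , ≤-refl))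
    where
    Cone : Point → Set
    Cone (u , v) = (+ 1 ≤ u × v ≤ - u) ⊎ (u ≤ - + 1 × - u ≤ v)
    ∉Cone : ¬ Cone origin
    ∉Cone (inj₁ (+≤+ () , _))
    ∉Cone (inj₂ (() , _))
    from-positive : ∀ {u v w} → + 1 ≤ u → v ≤ - u → k + + 1 - P ≤ u + p1 * v + P * w → v ≤ - + 1 × - v ≤ w
    from-positive {u} {v} {w} 1≤u v≤-u lo = v≤-1 , ≤-by-contradiction λ w+1≤-v →
      infeasible (slack v≤-u ⊕ slack lo ⊕ slack (*-monoˡ-≤-positive P w+1≤-v)
                  ⊕ 0≤* (slack P+1≤p1) (slack v≤-1) ⊕ slack 0≤k ⊕ slack P+1≤p1)
                 (solve (P ∷ k ∷ p1 ∷ u ∷ v ∷ w ∷ []))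
      where
      v≤-1 : v ≤ - + 1
      v≤-1 = ≤-by (slack 1≤u ⊕ slack v≤-u) (solve (u ∷ v ∷ []))
    from-negative : ∀ {u v w} → u ≤ - + 1 → - u ≤ v → u + p1 * v + P * w ≤ k → + 1 ≤ v × w ≤ - v
    from-negative {u} {v} {w} u≤-1 -u≤v hi = 1≤v , ≤-by-contradiction λ -v+1≤w →
      infeasible (slack -u≤v ⊕ slack hi ⊕ slack (*-monoˡ-≤-positive P -v+1≤w)
                  ⊕ 0≤* (slack P+1≤p1) (slack 1≤v) ⊕ slack k+1≤P ⊕ slack P+1≤p1)
                 (solve (P ∷ k ∷ p1 ∷ u ∷ v ∷ w ∷ []))
      where
      1≤v : + 1 ≤ v
      1≤v = ≤-by (slack u≤-1 ⊕ slack -u≤v) (solve (u ∷ v ∷ []))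
    τ-closed : ∀ {z} → Cone z → Cone (τ z)
    τ-closed {u , v} (inj₁ (1≤u , v≤-u)) = inj₂ (from-positive 1≤u v≤-u (proj₁ (τ-window u v)))
    τ-closed {u , v} (inj₂ (u≤-1 , -u≤v)) = inj₁ (from-negative u≤-1 -u≤v (proj₂ (τ-window u v)))

  p1-too-small : p1 ≤ - k - + 2 → ¬ ReachesOrigin (- + 1 , - + 1)
  p1-too-small p1≤-k-2 with ≤⊎> p1 (- P - + 1)
  ... | inj₁ p1≤-P-1 = descending-cone p1≤-P-1
  ... | inj₂ p1>-P-1 = fixed[-1,-1] (≤-by (slack p1>-P-1 ⊕ slack 0≤k ⊕ 0≤+ 1) (solve (P ∷ k ∷ p1 ∷ []))) p1≤-k-2

  p1-too-large : P - k + + 1 ≤ p1 → ¬ ReachesOrigin (+ 1 , - + 1)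
  p1-too-large P-k+1≤p1 with ≤⊎> p1 (P + k + + 1)
  ... | inj₁ p1≤P+k+1 = cycle[1,-1] P-k+1≤p1 p1≤P+k+1
  ... | inj₂ p1>P+k+1 = alternating-cone (≤-by (slack p1>P+k+1 ⊕ slack 0≤k ⊕ 0≤+ 1) (solve (P ∷ k ∷ p1 ∷ [])))

  necessity : (∀ z → ReachesOrigin z) → (- k - + 1 ≤ p1) × (p1 ≤ P - k)
  necessity reach =
    ≤-by-contradiction (λ p1<-k-1 → p1-too-small (≤-by (slack p1<-k-1) (solve (k ∷ p1 ∷ []))) (reach _)) ,
    ≤-by-contradiction (λ p1>P-k → p1-too-large p1>P-k (reach _))

module NegativeNecessity (P p1 k : ℤ) {{_ : Positive P}} (0≤k : + 0 ≤ k) (2k+1≤P : k + k + + 1 ≤ P) where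
  open Dynamics P (- P) p1 k (inj₂ refl)

  k+1≤P : k + + 1 ≤ P
  k+1≤P = ≤-by (slack 2k+1≤P ⊕ slack 0≤k) (solve (P ∷ k ∷ []))

  cycle[1,0] : k ≤ + 0 → + 1 - P ≤ p1 → p1 ≤ + 0 → ¬ ReachesOrigin (+ 1 , + 0)
  cycle[1,0] k≤0 lo hi = two-cycle-unreachable
    (τ-unique (+ 1) (+ 0) (+ 1)
      (≤-by (slack k≤0) (solve (P ∷ k ∷ p1 ∷ [])) ,
       ≤-by (slack 0≤k ⊕ slack lo ⊕ slack hi) (solve (P ∷ k ∷ p1 ∷ []))))
    (τ-unique (+ 0) (+ 1) (+ 0)
      (≤-by (slack k≤0 ⊕ slack lo) (solve (P ∷ k ∷ p1 ∷ [])) ,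
       ≤-by (slack 0≤k ⊕ slack hi) (solve (P ∷ k ∷ p1 ∷ []))))
    (λ ()) (λ ())

  fixed[1,1] : k ≤ p1 → p1 ≤ k + P - + 1 → ¬ ReachesOrigin (+ 1 , + 1)
  fixed[1,1] lo hi = fixed-point-unreachable
    (τ-unique (+ 1) (+ 1) (+ 1) (≤-by (slack lo) (solve (P ∷ k ∷ p1 ∷ [])) , ≤-by (slack hi) (solve (P ∷ k ∷ p1 ∷ []))))
    (λ ())

  ascending-cone : k + P ≤ p1 → ¬ ReachesOrigin (+ 1 , + 1)
  ascending-cone k+P≤p1 = invariant-avoids-origin Cone τ-closed (λ { (+≤+ () , _) }) (≤-refl , ≤-refl)
    where
    Cone : Point → Set
    Cone (u , v) = (+ 1 ≤ u) × (u ≤ v)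
    v≤w : ∀ {u v w} → + 1 ≤ u → u ≤ v → u + p1 * v + - P * w ≤ k → v ≤ w
    v≤w {u} {v} {w} 1≤u u≤v hi = ≤-by-contradiction λ w+1≤v →
      infeasible (slack 1≤u ⊕ slack hi ⊕ slack (*-monoˡ-≤-positive P w+1≤v) ⊕ 0≤* (slack k+P≤p1) (slack 0≤v)
                  ⊕ 0≤* (slack 0≤k) (slack 1≤v) ⊕ slack 0≤k ⊕ slack k+1≤P ⊕ 0≤+ 1)
                 (solve (P ∷ k ∷ p1 ∷ u ∷ v ∷ w ∷ []))
      where
      1≤v : + 1 ≤ v
      1≤v = ≤-trans 1≤u u≤v
      0≤v : + 0 ≤ v
      0≤v = ≤-trans (0≤+ 1) 1≤v
    τ-closed : ∀ {z} → Cone z → Cone (τ z)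
    τ-closed {u , v} (1≤u , u≤v) = ≤-trans 1≤u u≤v , v≤w 1≤u u≤v (proj₂ (τ-window u v))

  cycle[1,-1] : + 1 - P - k ≤ p1 → p1 ≤ k + + 1 - P → ¬ ReachesOrigin (+ 1 , - + 1)
  cycle[1,-1] lo hi = two-cycle-unreachable
    (τ-unique (+ 1) (- + 1) (+ 1)
      (≤-by (slack hi ⊕ slack 2k+1≤P) (solve (P ∷ k ∷ p1 ∷ [])) ,
       ≤-by (slack lo) (solve (P ∷ k ∷ p1 ∷ []))))
    (τ-unique (- + 1) (+ 1) (- + 1)
      (≤-by (slack lo ⊕ slack 2k+1≤P) (solve (P ∷ k ∷ p1 ∷ [])) ,
       ≤-by (slack hi) (solve (P ∷ k ∷ p1 ∷ []))))
    (λ ()) (λ ())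

  alternating-cone : p1 ≤ - P - k → ¬ ReachesOrigin (+ 1 , - + 1)
  alternating-cone p1≤-P-k = invariant-avoids-origin Cone τ-closed ∉Cone (inj₁ (≤-refl , ≤-refl))
    where
    Cone : Point → Set
    Cone (u , v) = (+ 1 ≤ u × v ≤ - u) ⊎ (u ≤ - + 1 × - u ≤ v)
    ∉Cone : ¬ Cone origin
    ∉Cone (inj₁ (+≤+ () , _))
    ∉Cone (inj₂ (() , _))
    from-positive : ∀ {u v w} → + 1 ≤ u → v ≤ - u → u + p1 * v + - P * w ≤ k → v ≤ - + 1 × - v ≤ w
    from-positive {u} {v} {w} 1≤u v≤-u hi = v≤-1 , ≤-by-contradiction λ w+1≤-v →
      infeasible (slack 1≤u ⊕ slack hi ⊕ slack (*-monoˡ-≤-positive P w+1≤-v) ⊕ 0≤* (slack p1≤-P-k) (slack v≤0)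
                  ⊕ 0≤* (slack 0≤k) (slack v≤0) ⊕ slack k+1≤P ⊕ 0≤+ 1)
                 (solve (P ∷ k ∷ p1 ∷ u ∷ v ∷ w ∷ []))
      where
      v≤-1 : v ≤ - + 1
      v≤-1 = ≤-by (slack 1≤u ⊕ slack v≤-u) (solve (u ∷ v ∷ []))
      v≤0 : v ≤ + 0
      v≤0 = ≤-trans v≤-1 -≤+
    from-negative : ∀ {u v w} → u ≤ - + 1 → - u ≤ v → k + + 1 - P ≤ u + p1 * v + - P * w → + 1 ≤ v × w ≤ - v
    from-negative {u} {v} {w} u≤-1 -u≤v lo = 1≤v , ≤-by-contradiction λ -v+1≤w →
      infeasible (slack u≤-1 ⊕ slack lo ⊕ slack (*-monoˡ-≤-positive P -v+1≤w) ⊕ 0≤* (slack p1≤-P-k) (slack 0≤v)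
                  ⊕ 0≤* (slack 0≤k) (slack 0≤v) ⊕ slack 0≤k ⊕ 0≤+ 1)
                 (solve (P ∷ k ∷ p1 ∷ u ∷ v ∷ w ∷ []))
      where
      1≤v : + 1 ≤ v
      1≤v = ≤-by (slack u≤-1 ⊕ slack -u≤v) (solve (u ∷ v ∷ []))
      0≤v : + 0 ≤ v
      0≤v = ≤-trans (0≤+ 1) 1≤v
    τ-closed : ∀ {z} → Cone z → Cone (τ z)
    τ-closed {u , v} (inj₁ (1≤u , v≤-u)) = inj₂ (from-positive 1≤u v≤-u (proj₂ (τ-window u v)))
    τ-closed {u , v} (inj₂ (u≤-1 , -u≤v)) = inj₁ (from-negative u≤-1 -u≤v (proj₁ (τ-window u v)))

  p1-too-large : k ≤ p1 → ¬ ReachesOrigin (+ 1 , + 1)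
  p1-too-large k≤p1 with ≤⊎> p1 (k + P - + 1)
  ... | inj₁ p1≤k+P-1 = fixed[1,1] k≤p1 p1≤k+P-1
  ... | inj₂ p1>k+P-1 = ascending-cone (≤-by (slack p1>k+P-1) (solve (P ∷ k ∷ p1 ∷ [])))

  p1-too-small : p1 ≤ k + + 1 - P → ¬ ReachesOrigin (+ 1 , - + 1)
  p1-too-small p1≤k+1-P with ≤⊎> p1 (- P - k)
  ... | inj₁ p1≤-P-k = alternating-cone p1≤-P-k
  ... | inj₂ p1>-P-k = cycle[1,-1] (≤-by (slack p1>-P-k) (solve (P ∷ k ∷ p1 ∷ []))) p1≤k+1-P

  necessity : (∀ z → ReachesOrigin z) → (+ 1 ≤ k) × (k + + 2 - P ≤ p1) × (p1 ≤ k - + 1)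
  necessity reach = 1≤k , k+2-P≤p1 , p1≤k-1
    where
    p1≤k-1 : p1 ≤ k - + 1
    p1≤k-1 = ≤-by-contradiction λ p1>k-1 → p1-too-large (≤-by (slack p1>k-1) (solve (k ∷ p1 ∷ []))) (reach _)
    k+2-P≤p1 : k + + 2 - P ≤ p1
    k+2-P≤p1 = ≤-by-contradiction λ p1<k+2-P → p1-too-small (≤-by (slack p1<k+2-P) (solve (P ∷ k ∷ p1 ∷ []))) (reach _)
    1≤k : + 1 ≤ k
    1≤k = ≤-by-contradiction λ k<1 → cycle[1,0] (≤-by (slack k<1) (solve (k ∷ [])))
      (≤-by (slack k+2-P≤p1 ⊕ slack 0≤k ⊕ 0≤+ 1) (solve (P ∷ k ∷ p1 ∷ [])))
      (≤-by (slack p1≤k-1 ⊕ slack k<1 ⊕ 0≤+ 1) (solve (k ∷ p1 ∷ [])))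
      (reach _)

AllReach : (P p0 p1 k : ℤ) {{_ : Positive P}} → p0 ≡ P ⊎ p0 ≡ - P → Set
AllReach P p0 p1 k p0≡±P = ∀ z → Dynamics.ReachesOrigin P p0 p1 k p0≡±P z

Admissible : (P p0 p1 k : ℤ) → Set
Admissible P p0 p1 k = (- k - + 1 ≤ p1 × p1 ≤ P - k × + 2 ≤ p0) ⊎ (k + + 2 - P ≤ p1 × p1 ≤ k - + 1 × p0 ≤ - + 3 × + 1 ≤ k)

classification : ∀ {P p0 p1 k} {{_ : Positive P}} (p0≡±P : p0 ≡ P ⊎ p0 ≡ - P) →
                 + 0 ≤ k → k + k + + 1 ≤ P → + 2 ≤ P → AllReach P p0 p1 k p0≡±P ⇔ Admissible P p0 p1 k
classification {P} {p0} {p1} {k} (inj₁ refl) 0≤k 2k+1≤P 2≤P = mk⇔ necessary sufficient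
  where
  necessary : AllReach P P p1 k (inj₁ refl) → Admissible P P p1 k
  necessary reach = let lo , hi = PositiveNecessity.necessity P p1 k 0≤k 2k+1≤P reach in inj₁ (lo , hi , 2≤P)
  sufficient : Admissible P P p1 k → AllReach P P p1 k (inj₁ refl)
  sufficient (inj₂ (_ , _ , P≤-3 , _)) = ⊥-elim (infeasible (slack 2≤P ⊕ slack P≤-3 ⊕ 0≤+ 4) (solve (P ∷ [])))
  sufficient (inj₁ (lo , hi , _)) with ≤⊎> p1 (P - + 1)
  ... | inj₁ p1<P = PositiveBox.all-reach P p1 k 0≤k 2k+1≤P 2≤P lo hi p1<P
  ... | inj₂ P≤p1 = subst₂ (λ p1 k → AllReach P P p1 k (inj₁ refl)) (sym p1≡P) (sym k≡0) (PositiveEdge.all-reach P 2≤P)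
    where
    k≡0 : k ≡ + 0
    k≡0 = ≤-antisym (≤-by (slack P≤p1 ⊕ slack hi) (solve (P ∷ k ∷ p1 ∷ []))) 0≤k
    p1≡P : p1 ≡ P
    p1≡P = ≤-antisym (≤-by (slack hi ⊕ slack 0≤k) (solve (P ∷ k ∷ p1 ∷ []))) (≤-by (slack P≤p1) (solve (P ∷ p1 ∷ [])))
classification {P} {p0} {p1} {k} (inj₂ refl) 0≤k 2k+1≤P 2≤P = mk⇔ necessary sufficient
  where
  necessary : AllReach P (- P) p1 k (inj₂ refl) → Admissible P (- P) p1 k
  necessary reach =
    let 1≤k , lo , hi = NegativeNecessity.necessity P p1 k 0≤k 2k+1≤P reach
    in inj₂ (lo , hi , ≤-by (2 ⊛ slack 1≤k ⊕ slack 2k+1≤P) (solve (P ∷ k ∷ [])) , 1≤k)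
  sufficient : Admissible P (- P) p1 k → AllReach P (- P) p1 k (inj₂ refl)
  sufficient (inj₁ (_ , _ , 2≤-P)) = ⊥-elim (infeasible (slack 2≤-P ⊕ slack 2≤P ⊕ 0≤+ 3) (solve (P ∷ [])))
  sufficient (inj₂ (lo , hi , _ , 1≤k)) = NegativeBox.all-reach P p1 k 1≤k 2k+1≤P lo hi

AdmissibleMirrored : (P p0 p1 k : ℤ) → Set
AdmissibleMirrored P p0 p1 k =
  (- P + k ≤ p1 × p1 ≤ k + + 1 × + 2 ≤ p0) ⊎ (- k + + 1 ≤ p1 × p1 ≤ - k - + 2 + P × p0 ≤ - + 3 × k + + 2 ≤ P)

admissible-mirrored : ∀ {P p0 p1 k} → Admissible P p0 p1 (P - + 1 - k) ⇔ AdmissibleMirrored P p0 p1 k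
admissible-mirrored {P} {p0} {p1} {k} = mk⇔ to from
  where
  to : Admissible P p0 p1 (P - + 1 - k) → AdmissibleMirrored P p0 p1 k
  to (inj₁ (lo , hi , 2≤p0)) =
    inj₁ (≤-by (slack lo) (solve (P ∷ k ∷ p1 ∷ [])) , ≤-by (slack hi) (solve (P ∷ k ∷ p1 ∷ [])) , 2≤p0)
  to (inj₂ (lo , hi , p0≤-3 , 1≤k′)) =
    inj₂ (≤-by (slack lo) (solve (P ∷ k ∷ p1 ∷ [])) , ≤-by (slack hi) (solve (P ∷ k ∷ p1 ∷ [])) ,
          p0≤-3 , ≤-by (slack 1≤k′) (solve (P ∷ k ∷ [])))
  from : AdmissibleMirrored P p0 p1 k → Admissible P p0 p1 (P - + 1 - k)
  from (inj₁ (lo , hi , 2≤p0)) =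
    inj₁ (≤-by (slack lo) (solve (P ∷ k ∷ p1 ∷ [])) , ≤-by (slack hi) (solve (P ∷ k ∷ p1 ∷ [])) , 2≤p0)
  from (inj₂ (lo , hi , p0≤-3 , k+2≤P)) =
    inj₂ (≤-by (slack lo) (solve (P ∷ k ∷ p1 ∷ [])) , ≤-by (slack hi) (solve (P ∷ k ∷ p1 ∷ [])) ,
          p0≤-3 , ≤-by (slack k+2≤P) (solve (P ∷ k ∷ [])))

classification-mirrored : ∀ {P p0 p1 k} {{_ : Positive P}} (p0≡±P : p0 ≡ P ⊎ p0 ≡ - P) →
                          + 0 ≤ k → k + + 1 ≤ P → P ≤ k + k + + 1 → + 2 ≤ P →
                          AllReach P p0 p1 k p0≡±P ⇔ AdmissibleMirrored P p0 p1 k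
classification-mirrored {P} {p0} {p1} {k} p0≡±P 0≤k k+1≤P P≤2k+1 2≤P =
  admissible-mirrored ⇔-∘ (classification p0≡±P 0≤k′ 2k′+1≤P 2≤P ⇔-∘ mirror)
  where
  0≤k′ : + 0 ≤ P - + 1 - k
  0≤k′ = ≤-by (slack k+1≤P) (solve (P ∷ k ∷ []))
  2k′+1≤P : P - + 1 - k + (P - + 1 - k) + + 1 ≤ P
  2k′+1≤P = ≤-by (slack P≤2k+1) (solve (P ∷ k ∷ []))
  mirror : AllReach P p0 p1 k p0≡±P ⇔ AllReach P p0 p1 (P - + 1 - k) p0≡±P
  mirror = mk⇔ (Mirror.all-reach-mirror P p0 p1 (P - + 1 - k) k p0≡±P (solve (P ∷ k ∷ [])))
               (Mirror.all-reach-mirror P p0 p1 k (P - + 1 - k) p0≡±P (solve (P ∷ k ∷ [])))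

fromℤ-normal : ∀ z → fromℤ z ≡ mkℚ z 0 (Coprimality.sym (Coprimality.1-coprimeTo ∣ z ∣))
fromℤ-normal (+ n) = ℚ.normalize-coprime (Coprimality.sym (Coprimality.1-coprimeTo n))
fromℤ-normal -[1+ n ] = cong ℚ.-_ (ℚ.normalize-coprime (Coprimality.sym (Coprimality.1-coprimeTo (suc n))))

fromℤ-cancel-≤ : ∀ {a b} → fromℤ a ℚ.≤ fromℤ b → a ≤ b
fromℤ-cancel-≤ {a} {b} a≤b rewrite fromℤ-normal a | fromℤ-normal b with a≤b
... | *≤* a*1≤b*1 = subst₂ _≤_ (*-identityʳ a) (*-identityʳ b) a*1≤b*1

fromℤ-mono-< : ∀ {a b} → a < b → fromℤ a ℚ.< fromℤ b
fromℤ-mono-< {a} {b} a<b rewrite fromℤ-normal a | fromℤ-normal b =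
  *<* (subst₂ _<_ (sym (*-identityʳ a)) (sym (*-identityʳ b)) a<b)

fromℤ-cancel-< : ∀ {a b} → fromℤ a ℚ.< fromℤ b → a < b
fromℤ-cancel-< {a} {b} a<b rewrite fromℤ-normal a | fromℤ-normal b with a<b
... | *<* a*1<b*1 = subst₂ _<_ (*-identityʳ a) (*-identityʳ b) a*1<b*1

fromℤ-+ : ∀ a b → fromℤ (a + b) ≡ fromℤ a ℚ.+ fromℤ b
fromℤ-+ a b rewrite fromℤ-normal a | fromℤ-normal b =
  cong (λ n → n ℚ./ 1) (cong₂ _+_ (sym (*-identityʳ a)) (sym (*-identityʳ b)))

fromℤ-neg : ∀ z → fromℤ (- z) ≡ ℚ.- fromℤ z
fromℤ-neg z rewrite fromℤ-normal z | fromℤ-normal (- z) = lemma z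
  where
  lemma : ∀ z → mkℚ (- z) 0 (Coprimality.sym (Coprimality.1-coprimeTo ∣ - z ∣)) ≡
                ℚ.- mkℚ z 0 (Coprimality.sym (Coprimality.1-coprimeTo ∣ z ∣))
  lemma (+ zero) = refl
  lemma (+ suc n) = refl
  lemma -[1+ n ] = refl

quotient-greatest : ∀ {n q r D z} → n ≡ r + q * D → + 1 + r ≤ D →
                    (∀ {a b} → a ≤ b → a * D ≤ b * D) → z * D ≤ n → z ≤ q
quotient-greatest {q = q} {r} {D} {z} refl r<D *D-mono zD≤n = ≤-by-contradiction λ q+1≤z →
  infeasible (slack (*D-mono q+1≤z) ⊕ slack zD≤n ⊕ slack r<D) (solve (q ∷ r ∷ D ∷ z ∷ []))

floor-greatest : ∀ x z → z ≤ floor x ⇔ fromℤ z ℚ.≤ x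
floor-greatest (mkℚ n d _) z = mk⇔ to from
  where
  D : ℤ
  D = +[1+ d ]
  to : z ≤ n ℤ./ D → fromℤ z ℚ.≤ mkℚ n d _
  to z≤q rewrite fromℤ-normal z =
    *≤* (≤-trans (*-monoʳ-≤-nonNeg D z≤q) (≤-trans ([n/d]*d≤n n D) (≤-reflexive (sym (*-identityʳ n)))))
  from : fromℤ z ℚ.≤ mkℚ n d _ → z ≤ n ℤ./ D
  from z≤x rewrite fromℤ-normal z with z≤x
  ... | *≤* zD≤n = quotient-greatest {r = + (n ℤ.% D)} {D = D} (a≡a%n+[a/n]*n n D) (+≤+ (n%d<d n D)) (*-monoʳ-≤-nonNeg D)
                     (≤-trans zD≤n (≤-reflexive (*-identityʳ n)))

floor-least : ∀ x z → floor x + + 1 ≤ z ⇔ x ℚ.< fromℤ z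
floor-least x z = strict (floor x) (floor-greatest x z)
  where
  strict : ∀ f → z ≤ f ⇔ fromℤ z ℚ.≤ x → f + + 1 ≤ z ⇔ x ℚ.< fromℤ z
  strict f galois = mk⇔ to′ from′
    where
    open Equivalence galois
    to′ : f + + 1 ≤ z → x ℚ.< fromℤ z
    to′ f+1≤z = ℚ.≰⇒> λ z≤x → infeasible (slack f+1≤z ⊕ slack (from z≤x)) (solve (f ∷ z ∷ []))
    from′ : x ℚ.< fromℤ z → f + + 1 ≤ z
    from′ x<z = ≤-by-contradiction λ z+1≤f+1 → ℚ.<-irrefl refl (ℚ.<-≤-trans x<z (to (z≤f z+1≤f+1)))
      where
      z≤f : z + + 1 ≤ f + + 1 → z ≤ f
      z≤f z+1≤f+1 = ≤-by (slack z+1≤f+1) (solve (f ∷ z ∷ []))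

module _ where
  open +-*-Solver renaming (solve to ℚ-solve)

  swap-< : ∀ {a b c} → a ℚ.< b ℚ.- c → c ℚ.< b ℚ.- a
  swap-< {a} {b} {c} a<b-c = subst₂ ℚ._<_
    (ℚ-solve 2 (λ a c → a :+ (c :- a) := c) refl a c)
    (ℚ-solve 3 (λ a b c → (b :- c) :+ (c :- a) := b :- a) refl a b c)
    (ℚ.+-monoˡ-< (c ℚ.- a) a<b-c)

  one-minus-* : ∀ ε X → (1ℚ ℚ.- ε) ℚ.* X ≡ X ℚ.- ε ℚ.* X
  one-minus-* = ℚ-solve 2 (λ ε X → (con 1ℚ :- ε) :* X := X :- ε :* X) refl

  halves : ∀ X → ½ ℚ.* X ℚ.+ ½ ℚ.* X ≡ X
  halves = ℚ-solve 1 (λ X → con ½ :* X :+ con ½ :* X := X) refl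

module Scaled (P : ℤ) {{_ : Positive P}} (ε : ℚ) where
  open Equivalence

  X x : ℚ
  X = fromℤ P
  x = ε ℚ.* X

  k : ℤ
  k = floor x

  private instance
    X>0 : ℚ.Positive X
    X>0 = ℚ.positive (fromℤ-mono-< (positive⁻¹ P))
    X≥0 : ℚ.NonNegative X
    X≥0 = ℚ.nonNegative (ℚ.<⇒≤ (fromℤ-mono-< (positive⁻¹ P)))

  0≤k : 0ℚ ℚ.≤ ε → + 0 ≤ k
  0≤k 0≤ε = from (floor-greatest x (+ 0)) (subst (ℚ._≤ x) (ℚ.*-zeroˡ X) (ℚ.*-monoʳ-≤-nonNeg X 0≤ε))

  k+1≤P : ε ℚ.< 1ℚ → k + + 1 ≤ P
  k+1≤P ε<1 = from (floor-least x P) (subst (x ℚ.<_) (ℚ.*-identityˡ X) (ℚ.*-monoˡ-<-pos X ε<1))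

  k≤x : fromℤ k ℚ.≤ x
  k≤x = to (floor-greatest x k) ≤-refl

  x<k+1 : x ℚ.< fromℤ (k + + 1)
  x<k+1 = to (floor-least x (k + + 1)) ≤-refl

  2k≤P : ε ℚ.≤ ½ → k + k ≤ P
  2k≤P ε≤½ = fromℤ-cancel-≤ (subst₂ ℚ._≤_ (sym (fromℤ-+ k k)) (halves X)
    (ℚ.+-mono-≤ (ℚ.≤-trans k≤x εX≤½X) (ℚ.≤-trans k≤x εX≤½X)))
    where
    εX≤½X : x ℚ.≤ ½ ℚ.* X
    εX≤½X = ℚ.*-monoʳ-≤-nonNeg X ε≤½

  2k<P : ε ℚ.< ½ → k + k + + 1 ≤ P
  2k<P ε<½ = <⇒+1≤ {k + k} (fromℤ-cancel-< (subst₂ ℚ._<_ (sym (fromℤ-+ k k)) (halves X)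
    (ℚ.+-mono-≤-< (ℚ.≤-trans k≤x (ℚ.<⇒≤ εX<½X)) (ℚ.≤-<-trans k≤x εX<½X))))
    where
    εX<½X : x ℚ.< ½ ℚ.* X
    εX<½X = ℚ.*-monoˡ-<-pos X ε<½

  P≤2k+1 : ½ ℚ.≤ ε → P ≤ k + k + + 1
  P≤2k+1 ½≤ε = halve {k} (fromℤ-cancel-< (subst₂ ℚ._<_ (halves X) (sym (fromℤ-+ (k + + 1) (k + + 1)))
    (ℚ.+-mono-≤-< (ℚ.≤-trans ½X≤εX (ℚ.<⇒≤ x<k+1)) (ℚ.≤-<-trans ½X≤εX x<k+1))))
    where
    ½X≤εX : ½ ℚ.* X ℚ.≤ x
    ½X≤εX = ℚ.*-monoʳ-≤-nonNeg X ½≤ε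
    halve : ∀ {a} → P < a + + 1 + (a + + 1) → P ≤ a + a + + 1
    halve {a} P<2a+2 = ≤-by (slack (<⇒+1≤ P<2a+2)) (solve (a ∷ P ∷ []))

  1≤k⇔1≤x : + 1 ≤ k ⇔ 1ℚ ℚ.≤ x
  1≤k⇔1≤x = floor-greatest x (+ 1)

  X-fromℤ : ∀ d → X ℚ.- fromℤ d ≡ fromℤ (P - d)
  X-fromℤ d = sym (trans (fromℤ-+ P (- d)) (cong (X ℚ.+_) (fromℤ-neg d)))

  digit⇔window : ∀ d → ((ℚ.- x ℚ.≤ fromℤ d) × (fromℤ d ℚ.< (1ℚ ℚ.- ε) ℚ.* X)) ⇔ ((k + + 1 - P ≤ - d) × (- d ≤ k))
  digit⇔window d = mk⇔ (λ (lo , hi) → upper-to hi , lower-to lo) (λ (lo , hi) → lower-from hi , upper-from lo)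
    where
    lower-to : ℚ.- x ℚ.≤ fromℤ d → - d ≤ k
    lower-to -x≤d = from (floor-greatest x (- d))
      (subst₂ ℚ._≤_ (sym (fromℤ-neg d)) (ℚ-neg-involutive x) (ℚ.neg-antimono-≤ -x≤d))
    lower-from : - d ≤ k → ℚ.- x ℚ.≤ fromℤ d
    lower-from -d≤k = subst (ℚ.- x ℚ.≤_) (ℚ-neg-involutive (fromℤ d))
      (ℚ.neg-antimono-≤ (subst (ℚ._≤ x) (fromℤ-neg d) (to (floor-greatest x (- d)) -d≤k)))
    shift : ∀ {a} → a + + 1 ≤ P - d → a + + 1 - P ≤ - d
    shift {a} h = ≤-by (slack h) (solve (a ∷ P ∷ d ∷ []))
    unshift : ∀ {a} → a + + 1 - P ≤ - d → a + + 1 ≤ P - d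
    unshift {a} h = ≤-by (slack h) (solve (a ∷ P ∷ d ∷ []))
    upper-to : fromℤ d ℚ.< (1ℚ ℚ.- ε) ℚ.* X → k + + 1 - P ≤ - d
    upper-to d<[1-ε]X = shift {k} (from (floor-least x (P - d))
      (subst (x ℚ.<_) (X-fromℤ d) (swap-< {b = X} (subst (fromℤ d ℚ.<_) (one-minus-* ε X) d<[1-ε]X))))
    upper-from : k + + 1 - P ≤ - d → fromℤ d ℚ.< (1ℚ ℚ.- ε) ℚ.* X
    upper-from k+1-P≤-d = subst (fromℤ d ℚ.<_) (sym (one-minus-* ε X))
      (swap-< {b = X} (subst (x ℚ.<_) (sym (X-fromℤ d)) (to (floor-least x (P - d)) (unshift {k} k+1-P≤-d))))

  k+2≤P⇔x<X-1 : k + + 2 ≤ P ⇔ x ℚ.< X ℚ.- 1ℚ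
  k+2≤P⇔x<X-1 = mk⇔
    (λ k+2≤P → subst (x ℚ.<_) (sym (X-fromℤ (+ 1))) (to (floor-least x (P - + 1)) (shift {k} k+2≤P)))
    (λ x<X-1 → unshift {k} (from (floor-least x (P - + 1)) (subst (x ℚ.<_) (X-fromℤ (+ 1)) x<X-1)))
    where
    shift : ∀ {a} → a + + 2 ≤ P → a + + 1 ≤ P - + 1
    shift {a} h = ≤-by (slack h) (solve (a ∷ P ∷ []))
    unshift : ∀ {a} → a + + 1 ≤ P - + 1 → a + + 2 ≤ P
    unshift {a} h = ≤-by (slack h) (solve (a ∷ P ∷ []))

on-last-condition : ∀ {A B C D E F : Set} → E ⇔ F → (A ⊎ (B × C × D × E)) ⇔ (A ⊎ (B × C × D × F))
on-last-condition E⇔F = mk⇔ (⊎-map₂ (map₂ (map₂ (map₂ (Equivalence.to E⇔F)))))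
                            (⊎-map₂ (map₂ (map₂ (map₂ (Equivalence.from E⇔F)))))

double-not-odd : ∀ {k n} → + 0 ≤ k → k + k ≡ + n → n % 2 ≡ 1 → ⊥
double-not-odd {+ j} {n} _ 2j≡n n-odd with trans (sym (m*n%n≡0 j 2)) (trans (cong (_% 2) j*2≡n) n-odd)
  where
  j*2≡n : j ℕ.* 2 ≡ n
  j*2≡n = trans (sym (trans (cong (j ℕ.+_) (sym (ℕ.+-identityʳ j))) (ℕ.*-comm 2 j))) (+-injective 2j≡n)
... | ()

i≡±∣i∣ : ∀ i → i ≡ + ∣ i ∣ ⊎ i ≡ - + ∣ i ∣
i≡±∣i∣ (+ n) = inj₁ refl
i≡±∣i∣ -[1+ n ] = inj₂ refl

theorem2p4 : (p1 p0 : ℤ) (ε : ℚ) → 2 Data.Nat.≤ ∣ p0 ∣ → 0ℚ ≤ℚ ε → ε <ℚ 1ℚ →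
    ((ε <ℚ ½ ⊎ (ε ≡ ½ × ∣ p0 ∣ % 2 ≡ 1)) →
      (IsεCNS ε p0 (quadP p1 p0) ⇔
        ((((- kOf ε p0) - + 1 ≤ p1) × (p1 ≤ (+ ∣ p0 ∣) - kOf ε p0) × (+ 2 ≤ p0))
        ⊎ (((kOf ε p0 + + 2) - + ∣ p0 ∣ ≤ p1) × (p1 ≤ kOf ε p0 - + 1) × (p0 ≤ - + 3)
           × (1ℚ ≤ℚ ε *ℚ absQ p0) × (ε ≤ℚ ½)))))
    × ((½ <ℚ ε ⊎ (ε ≡ ½ × ∣ p0 ∣ % 2 ≡ 0)) →
      (IsεCNS ε p0 (quadP p1 p0) ⇔
        ((((- (+ ∣ p0 ∣)) + kOf ε p0 ≤ p1) × (p1 ≤ kOf ε p0 + + 1) × (+ 2 ≤ p0))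
        ⊎ (((- kOf ε p0) + + 1 ≤ p1) × (p1 ≤ ((- kOf ε p0) - + 2) + + ∣ p0 ∣) × (p0 ≤ - + 3)
           × (½ ≤ℚ ε) × (ε *ℚ absQ p0 <ℚ absQ p0 -ℚ 1ℚ)))))
theorem2p4 p1 p0 ε 2≤∣p0∣ 0≤ε ε<1 =
  (λ c → on-last-condition (mk⇔ (λ 1≤k → to 1≤k⇔1≤x 1≤k , ε≤½ c) (from 1≤k⇔1≤x ∘ proj₁))
         ⇔-∘ (classification p0≡±P (0≤k 0≤ε) (2k+1≤P c) 2≤P ⇔-∘ expansions⇔all-reach)) ,
  (λ c → on-last-condition (mk⇔ (λ k+2≤P → ½≤ε c , to k+2≤P⇔x<X-1 k+2≤P) (from k+2≤P⇔x<X-1 ∘ proj₂))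
         ⇔-∘ (classification-mirrored p0≡±P (0≤k 0≤ε) (k+1≤P ε<1) (P≤2k+1 (½≤ε c)) 2≤P ⇔-∘ expansions⇔all-reach))
  where
  P : ℤ
  P = + ∣ p0 ∣
  instance
    P>0 : Positive P
    P>0 = positive (+<+ (ℕ.≤-trans (ℕ.s≤s ℕ.z≤n) 2≤∣p0∣))
  open Scaled P ε
  open Equivalence
  2≤P : + 2 ≤ P
  2≤P = +≤+ 2≤∣p0∣
  p0≡±P : p0 ≡ P ⊎ p0 ≡ - P
  p0≡±P = i≡±∣i∣ p0
  expansions⇔all-reach : IsεCNS ε p0 (quadP p1 p0) ⇔ AllReach P p0 p1 k p0≡±P
  expansions⇔all-reach =
    Expansions.has-expansions⇔all-reach P p0 p1 k p0≡±P (0≤k 0≤ε) (k+1≤P ε<1) (InDigits ε p0) digit⇔window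
  ε≤½ : ε <ℚ ½ ⊎ (ε ≡ ½ × ∣ p0 ∣ % 2 ≡ 1) → ε ≤ℚ ½
  ε≤½ = [ ℚ.<⇒≤ , ℚ.≤-reflexive ∘ proj₁ ]′
  2k+1≤P : ε <ℚ ½ ⊎ (ε ≡ ½ × ∣ p0 ∣ % 2 ≡ 1) → k + k + + 1 ≤ P
  2k+1≤P (inj₁ ε<½) = 2k<P ε<½
  2k+1≤P c@(inj₂ (_ , odd)) = <⇒+1≤ (≤∧≢⇒< (2k≤P (ε≤½ c)) (λ 2k≡P → double-not-odd (0≤k 0≤ε) 2k≡P odd))
  ½≤ε : ½ <ℚ ε ⊎ (ε ≡ ½ × ∣ p0 ∣ % 2 ≡ 0) → ½ ≤ℚ ε
  ½≤ε = [ ℚ.<⇒≤ , ℚ.≤-reflexive ∘ sym ∘ proj₁ ]′
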